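{- Let $n\ge2$ and $\widetilde{W}$ the affine Weyl group of type $\widetilde{C}_n$ with segments $\sigma(j)$ as in the context. For $1\le j,k\le 2n$, the product $\sigma(j)\sigma(k)$ lies in $\widetilde{W}^S$ and satisfies $\ell(\sigma(j)\sigma(k))=j+k$ if and only if $1\le j<k\le 2n$ or $n<j=k\le 2n$.
   Context: $\widetilde{W}$ is the Coxeter group with generators $s_0,\dots,s_n$ where $m(s_0,s_1)=4$, $m(s_i,s_{i+1})=3$ for $1\le i\le n-2$, $m(s_{n-1},s_n)=4$, all other pairs commuting. $S=\{s_1,\dots,s_n\}$ and $\widetilde{W}^S$ is the set of minimal length representatives of the cosets $wW_S$. For $1\le j\le 2n$: $\sigma(j)=s_{j-1}\cdots s_2s_1s_0$ if $1\le j\le n+1$ (so $\sigma(1)=s_0$), and $\sigma(j)=s_{2n-j+1}\cdots s_{n-1}s_ns_{n-1}\cdots s_2s_1s_0$ if $n+1<j\le 2n$; $\sigma(j)$ has length $j$. -}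

module Defs where

open import Data.Nat using (ℕ; zero; suc; _+_; _∸_; _≤_; _≡ᵇ_)
open import Data.Bool using (Bool; true; false; if_then_else_; _∧_; _∨_)
open import Data.Fin using (Fin; toℕ)
import Data.Fin as F
open import Data.List using (List; []; _∷_; _++_; length; map; downFrom; applyUpTo)
open import Data.List.Relation.Unary.All using (All)
open import Data.Product using (Σ; _×_; ∃)
open import Relation.Binary.PropositionalEquality using (_≡_; _≢_)
open import Relation.Nullary using (¬_)

Gen : ℕ → Set
Gen n = Fin (suc n)

Word : ℕ → Set
Word n = List (Gen n)

-- Coxeter matrix entry m(s_a, s_b) for a ≠ b (on natural-number indices):
-- 4 for {0,1} and {n-1,n}; 3 for other adjacent pairs; 2 otherwise.
coxℕ : ℕ → ℕ → ℕ → ℕ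
coxℕ n a b =
  if ((a ≡ᵇ 0) ∧ (b ≡ᵇ 1)) ∨ ((a ≡ᵇ 1) ∧ (b ≡ᵇ 0)) then 4
  else if ((suc a ≡ᵇ n) ∧ (b ≡ᵇ n)) ∨ ((suc b ≡ᵇ n) ∧ (a ≡ᵇ n)) then 4
  else if (suc a ≡ᵇ b) ∨ (suc b ≡ᵇ a) then 3
  else 2

cox : (n : ℕ) → Gen n → Gen n → ℕ
cox n s t = coxℕ n (toℕ s) (toℕ t)

alt : ∀ {n} → Gen n → Gen n → ℕ → Word n
alt s t zero = []
alt s t (suc k) = s ∷ alt t s k

data _≈_ {n : ℕ} : Word n → Word n → Set where
  ≈-refl  : ∀ {u} → u ≈ u
  ≈-sym   : ∀ {u v} → u ≈ v → v ≈ u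
  ≈-trans : ∀ {u v w} → u ≈ v → v ≈ w → u ≈ w
  ≈-sq    : ∀ (s : Gen n) → (s ∷ s ∷ []) ≈ []
  ≈-braid : ∀ (s t : Gen n) → s ≢ t → alt s t (cox n s t) ≈ alt t s (cox n s t)
  ≈-ctx   : ∀ x {u v} y → u ≈ v → (x ++ u ++ y) ≈ (x ++ v ++ y)

HasLength : ∀ {n} → Word n → ℕ → Set
HasLength {n} w L =
  (Σ (Word n) λ u → u ≈ w × length u ≡ L) × (∀ v → v ≈ w → L ≤ length v)

SWord : ∀ {n} → Word n → Set
SWord u = All (λ s → ¬ (s ≡ F.zero)) u

InWS : ∀ {n} → Word n → Set
InWS {n} w = ∀ (u : Word n) → SWord u → ∀ v → v ≈ (w ++ u) →
  Σ (Word n) λ x → x ≈ w × length x ≤ length v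

-- natural number to generator (clamped; only used with indices ≤ n)
gen : (n : ℕ) → ℕ → Gen n
gen n zero = F.zero
gen zero (suc k) = F.zero
gen (suc n) (suc k) = F.suc (gen n k)

-- σ(j) as a list of generator indices (leftmost letter first)
σℕ : ℕ → ℕ → List ℕ
σℕ n j = if j Data.Nat.≤ᵇ suc n then downFrom j
         else applyUpTo (λ i → (2 Data.Nat.* n ∸ j + 1) + i) (j ∸ suc n) ++ (n ∷ downFrom n)

σ : (n : ℕ) → ℕ → Word n
σ n j = map (gen n) (σℕ n j)

module Submission where

-- Lower bounds on lengths come from a concrete model.  W̃ acts on ℤⁿ by s₀ : x₁ ↦ 1 − x₁,
-- sᵢ : xᵢ ↔ xᵢ₊₁ and sₙ : xₙ ↦ −xₙ; this action respects all Coxeter relations.  A potential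
-- counting the affine walls between a point and the fundamental alcove changes by at most one
-- under each generator and vanishes at the origin, which W_S fixes.  Hence a word every letter of
-- which raises the potential of the origin ("ascending") is reduced and minimal in its coset.
-- Forward direction: for admissible (j, k) we follow the origin along σ(k) and then σ(j) and
-- check that every step ascends.  Backward direction: for the remaining pairs we derive, in the
-- Coxeter presentation itself, a relation σ(j)σ(k)u = v with u ∈ W_S and |v| < j + k, which
-- contradicts minimality in the coset.

open import Defs
open import Data.Nat
open import Data.Nat.Properties as ℕₚ using ()
open import Data.Integer as ℤ using (ℤ; -[1+_]; 0ℤ; 1ℤ)
import Data.Integer.Properties as ℤₚ
open import Data.Integer.Tactic.RingSolver using (solve-∀)
import Data.Nat.Tactic.RingSolver as NS
open import Data.Sum as Sum using (_⊎_; inj₁; inj₂)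
open import Data.Bool using (true; false; _∧_)
open import Data.Bool.Properties using (∨-comm; ∧-comm; ∧-zeroʳ; T-≡; ¬-not)
open import Data.Fin as Fin using (toℕ)
open import Data.Fin.Properties using (toℕ-injective; toℕ<n)
open import Data.List using (List; []; _∷_; _++_; [_]; length; map; replicate; downFrom; applyUpTo; take; drop)
import Data.List.Relation.Unary.All as All
open import Data.List.Relation.Unary.All using (All; []; _∷_)
open import Data.List.Properties using (map-++; length-map; length-replicate; length-++; ++-assoc; ++-identityʳ; length-take; take++drop≡id)
import Data.List.Relation.Unary.All.Properties as AllP
open import Data.Empty using (⊥; ⊥-elim)
open import Data.Unit using (⊤; tt)
open import Data.Product as Prod using (Σ; _×_; _,_; proj₁; proj₂)
open import Relation.Binary.PropositionalEquality hiding ([_])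
open import Level using (0ℓ)
open import Relation.Binary.Bundles using (Setoid)
open import Relation.Binary.Definitions using (tri<; tri≈; tri>)
open import Relation.Nullary using (¬_; yes; no)
open import Relation.Nullary.Decidable using (_⊎-dec_; _×-dec_)
open import Function.Bundles using (_⇔_; mk⇔; Equivalence)

toℕ-gen : ∀ n a → a ≤ n → toℕ (gen n a) ≡ a
toℕ-gen n       zero    _         = refl
toℕ-gen zero    (suc a) ()
toℕ-gen (suc n) (suc a) (s≤s a≤n) = cong suc (toℕ-gen n a a≤n)

reflect₀ : List ℤ → List ℤ
reflect₀ []      = []
reflect₀ (u ∷ x) = (1ℤ ℤ.- u) ∷ x

-- reflectAt i is s_{i+1}: it swaps positions i and i+1, or negates position i if it is the last one.
reflectAt : ℕ → List ℤ → List ℤ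
reflectAt zero    []          = []
reflectAt zero    (u ∷ [])    = ℤ.- u ∷ []
reflectAt zero    (u ∷ v ∷ x) = v ∷ u ∷ x
reflectAt (suc i) []          = []
reflectAt (suc i) (u ∷ x)     = u ∷ reflectAt i x

reflect : ℕ → List ℤ → List ℤ
reflect zero    = reflect₀
reflect (suc i) = reflectAt i

act : List ℕ → List ℤ → List ℤ
act []      x = x
act (a ∷ w) x = reflect a (act w x)

act-++ : ∀ u v x → act (u ++ v) x ≡ act u (act v x)
act-++ []      v x = refl
act-++ (a ∷ u) v x = cong (reflect a) (act-++ u v x)

length-reflect : ∀ a x → length (reflect a x) ≡ length x
length-reflect zero    []          = refl
length-reflect zero    (u ∷ x)     = refl
length-reflect (suc i) x           = go i x
  where
  go : ∀ i x → length (reflectAt i x) ≡ length x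
  go zero    []          = refl
  go zero    (u ∷ [])    = refl
  go zero    (u ∷ v ∷ x) = refl
  go (suc i) []          = refl
  go (suc i) (u ∷ x)     = cong suc (go i x)

length-act : ∀ w x → length (act w x) ≡ length x
length-act []      x = refl
length-act (a ∷ w) x = trans (length-reflect a (act w x)) (length-act w x)

reflect-involutive : ∀ a x → reflect a (reflect a x) ≡ x
reflect-involutive zero    []      = refl
reflect-involutive zero    (u ∷ x) = cong (_∷ x) (1-1- u)
  where
  1-1- : ∀ u → 1ℤ ℤ.- (1ℤ ℤ.- u) ≡ u
  1-1- = solve-∀
reflect-involutive (suc i) x       = go i x
  where
  go : ∀ i x → reflectAt i (reflectAt i x) ≡ x
  go zero    []          = refl
  go zero    (u ∷ [])    = cong (_∷ []) (ℤₚ.neg-involutive u)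
  go zero    (u ∷ v ∷ x) = refl
  go (suc i) []          = refl
  go (suc i) (u ∷ x)     = cong (u ∷_) (go i x)

reflect-comm : ∀ a c x → reflect a (reflect (2 + a + c) x) ≡ reflect (2 + a + c) (reflect a x)
reflect-comm zero    c []      = refl
reflect-comm zero    c (u ∷ x) = refl
reflect-comm (suc i) c x       = go i x
  where
  go : ∀ i x → reflectAt i (reflectAt (2 + i + c) x) ≡ reflectAt (2 + i + c) (reflectAt i x)
  go zero    []          = refl
  go zero    (u ∷ [])    = refl
  go zero    (u ∷ v ∷ x) = refl
  go (suc i) []          = refl
  go (suc i) (u ∷ x)     = cong (u ∷_) (go i x)

alternate : ℕ → ℕ → ℕ → List ℤ → List ℤ
alternate a b zero    x = x
alternate a b (suc k) x = reflect a (alternate b a k x)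

braid₀₁ : ∀ x → 2 ≤ length x → alternate 0 1 4 x ≡ alternate 1 0 4 x
braid₀₁ (u ∷ v ∷ x) _         = refl
braid₀₁ (u ∷ [])    (s≤s ())

braid-middle : ∀ i x → 3 + i ≤ length x →
  alternate (1 + i) (2 + i) 3 x ≡ alternate (2 + i) (1 + i) 3 x
braid-middle zero    (u ∷ v ∷ w ∷ x) _         = refl
braid-middle zero    (u ∷ [])        (s≤s ())
braid-middle zero    (u ∷ v ∷ [])    (s≤s (s≤s ()))
braid-middle (suc i) (u ∷ x)         (s≤s len) = cong (u ∷_) (braid-middle i x len)

braid-end : ∀ i x → length x ≡ 2 + i →
  alternate (1 + i) (2 + i) 4 x ≡ alternate (2 + i) (1 + i) 4 x
braid-end zero    (u ∷ v ∷ []) _   = refl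
braid-end (suc i) (u ∷ x)      len = cong (u ∷_) (braid-end i x (ℕₚ.suc-injective len))

≢⇒≡ᵇ-false : ∀ m k → m ≢ k → (m ≡ᵇ k) ≡ false
≢⇒≡ᵇ-false m k m≢k = ¬-not (λ eq → m≢k (ℕₚ.≡ᵇ⇒≡ m k (Equivalence.from T-≡ eq)))

<⇒≡ᵇ-false : ∀ {m k} → m < k → (m ≡ᵇ k) ≡ false
<⇒≡ᵇ-false {m} {k} m<k = ≢⇒≡ᵇ-false m k (ℕₚ.<⇒≢ m<k)

>⇒≡ᵇ-false : ∀ {m k} → k < m → (m ≡ᵇ k) ≡ false
>⇒≡ᵇ-false {m} {k} k<m = ≢⇒≡ᵇ-false m k (ℕₚ.>⇒≢ k<m)

≡ᵇ-refl : ∀ m → (m ≡ᵇ m) ≡ true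
≡ᵇ-refl m = Equivalence.to T-≡ (ℕₚ.≡⇒≡ᵇ m m refl)

cox-far : ∀ n a c → 2 + a + c ≤ n → coxℕ n a (2 + a + c) ≡ 2
cox-far n a c le
  rewrite ∧-zeroʳ (a ≡ᵇ 0) | ∧-zeroʳ (a ≡ᵇ 1)
        | <⇒≡ᵇ-false {suc a} {n} (ℕₚ.<-≤-trans (s≤s (s≤s (ℕₚ.m≤m+n a c))) le)
        | <⇒≡ᵇ-false {a} {n} (ℕₚ.<-≤-trans (ℕₚ.m≤n⇒m≤1+n (s≤s (ℕₚ.m≤m+n a c))) le)
        | ∧-zeroʳ (suc (suc (suc (a + c))) ≡ᵇ n)
        | <⇒≡ᵇ-false {a} {suc (a + c)} (s≤s (ℕₚ.m≤m+n a c))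
        | >⇒≡ᵇ-false {suc (suc (suc (a + c)))} {a} (ℕₚ.m≤n⇒m≤1+n (ℕₚ.m≤n⇒m≤1+n (s≤s (ℕₚ.m≤m+n a c))))
        = refl

cox-middle : ∀ n i → 3 + i ≤ n → coxℕ n (1 + i) (2 + i) ≡ 3
cox-middle n i le
  rewrite ∧-zeroʳ (i ≡ᵇ 0)
        | <⇒≡ᵇ-false {2 + i} {n} le
        | <⇒≡ᵇ-false {1 + i} {n} (ℕₚ.<⇒≤ le)
        | ∧-zeroʳ (3 + i ≡ᵇ n)
        | ≡ᵇ-refl i
        = refl

cox-end : ∀ i → coxℕ (2 + i) (1 + i) (2 + i) ≡ 4
cox-end i rewrite ∧-zeroʳ (i ≡ᵇ 0) | ≡ᵇ-refl i = refl

coxℕ-sym : ∀ n a b → coxℕ n a b ≡ coxℕ n b a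
coxℕ-sym n a b
  rewrite ∧-comm (a ≡ᵇ 0) (b ≡ᵇ 1) | ∧-comm (a ≡ᵇ 1) (b ≡ᵇ 0)
        | ∨-comm ((b ≡ᵇ 1) ∧ (a ≡ᵇ 0)) ((b ≡ᵇ 0) ∧ (a ≡ᵇ 1))
        | ∨-comm ((suc a ≡ᵇ n) ∧ (b ≡ᵇ n)) ((suc b ≡ᵇ n) ∧ (a ≡ᵇ n))
        | ∨-comm (suc a ≡ᵇ b) (suc b ≡ᵇ a) = refl

braid-ordered : ∀ n a c x → 2 ≤ n → 1 + a + c ≤ n → length x ≡ n →
  alternate a (1 + a + c) (coxℕ n a (1 + a + c)) x ≡ alternate (1 + a + c) a (coxℕ n a (1 + a + c)) x
braid-ordered n a       (suc c) x _  le _   rewrite ℕₚ.+-suc a c | cox-far n a c le = reflect-comm a c x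
braid-ordered n zero    zero    x 2≤n _  len = braid₀₁ x (subst (2 ≤_) (sym len) 2≤n)
braid-ordered n (suc i) zero    x _  le len rewrite ℕₚ.+-identityʳ i with 2 + i ≟ n
... | yes refl rewrite cox-end i = braid-end i x len
... | no  ≢n  rewrite cox-middle n i (ℕₚ.≤∧≢⇒< le ≢n) =
  braid-middle i x (subst (3 + i ≤_) (sym len) (ℕₚ.≤∧≢⇒< le ≢n))

braid : ∀ n a b x → 2 ≤ n → a ≤ n → b ≤ n → a ≢ b → length x ≡ n →
  alternate a b (coxℕ n a b) x ≡ alternate b a (coxℕ n a b) x
braid n a b x 2≤n a≤n b≤n a≢b len with ℕₚ.<-cmp a b
... | tri≈ _ a≡b _ = ⊥-elim (a≢b a≡b)
... | tri< a<b _ _ =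
  subst (λ b → alternate a b (coxℕ n a b) x ≡ alternate b a (coxℕ n a b) x) (ℕₚ.m+[n∸m]≡n a<b)
    (braid-ordered n a (b ∸ suc a) x 2≤n (subst (_≤ n) (sym (ℕₚ.m+[n∸m]≡n a<b)) b≤n) len)
... | tri> _ _ b<a =
  subst (λ k → alternate a b k x ≡ alternate b a k x) (coxℕ-sym n b a)
    (sym (subst (λ a → alternate b a (coxℕ n b a) x ≡ alternate a b (coxℕ n b a) x) (ℕₚ.m+[n∸m]≡n b<a)
      (braid-ordered n b (a ∸ suc b) x 2≤n (subst (_≤ n) (sym (ℕₚ.m+[n∸m]≡n b<a)) a≤n) len)))

actWord : ∀ {n} → Word n → List ℤ → List ℤ
actWord w = act (map toℕ w)

actWord-alt : ∀ {n} (s t : Gen n) k x → actWord (alt s t k) x ≡ alternate (toℕ s) (toℕ t) k x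
actWord-alt s t zero    x = refl
actWord-alt s t (suc k) x = cong (reflect (toℕ s)) (actWord-alt t s k x)

actWord-++ : ∀ {n} (u v : Word n) x → actWord (u ++ v) x ≡ actWord u (actWord v x)
actWord-++ u v x rewrite map-++ toℕ u v = act-++ (map toℕ u) (map toℕ v) x

act-respects-≈ : ∀ {n} {u v : Word n} → 2 ≤ n → u ≈ v → ∀ x → length x ≡ n → actWord u x ≡ actWord v x
act-respects-≈ 2≤n ≈-refl          x len = refl
act-respects-≈ 2≤n (≈-sym u≈v)     x len = sym (act-respects-≈ 2≤n u≈v x len)
act-respects-≈ 2≤n (≈-trans u≈v v≈w) x len = trans (act-respects-≈ 2≤n u≈v x len) (act-respects-≈ 2≤n v≈w x len)
act-respects-≈ 2≤n (≈-sq s)        x len = reflect-involutive (toℕ s) x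
act-respects-≈ {n} 2≤n (≈-braid s t s≢t) x len = begin
  actWord (alt s t (cox n s t)) x                ≡⟨ actWord-alt s t (cox n s t) x ⟩
  alternate (toℕ s) (toℕ t) (cox n s t) x        ≡⟨ braid n (toℕ s) (toℕ t) x 2≤n (ℕₚ.≤-pred (toℕ<n s)) (ℕₚ.≤-pred (toℕ<n t))
                                                      (λ eq → s≢t (toℕ-injective eq)) len ⟩
  alternate (toℕ t) (toℕ s) (cox n s t) x        ≡⟨ actWord-alt t s (cox n s t) x ⟨
  actWord (alt t s (cox n s t)) x                ∎
  where open ≡-Reasoning
act-respects-≈ 2≤n (≈-ctx w {u} {v} y u≈v) x len = begin
  actWord (w ++ u ++ y) x                ≡⟨ actWord-++ w (u ++ y) x ⟩
  actWord w (actWord (u ++ y) x)         ≡⟨ cong (actWord w) (actWord-++ u y x) ⟩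
  actWord w (actWord u (actWord y x))    ≡⟨ cong (actWord w) (act-respects-≈ 2≤n u≈v (actWord y x)
                                                               (trans (length-act (map toℕ y) x) len)) ⟩
  actWord w (actWord v (actWord y x))    ≡⟨ cong (actWord w) (actWord-++ v y x) ⟨
  actWord w (actWord (v ++ y) x)         ≡⟨ actWord-++ w (v ++ y) x ⟨
  actWord (w ++ v ++ y) x                ∎
  where open ≡-Reasoning

-- walls t counts the walls {α = c}, c ∈ ℤ, that the value of a root α crosses when moving
-- from a small positive number to t: t − 1 of them if t > 0, none if t = 0, −t if t < 0.
walls : ℤ → ℕ
walls (ℤ.+ zero)  = 0
walls (ℤ.+ suc k) = k
walls -[1+ k ]  = suc k

-- The walls of the two roots xᵢ − xⱼ and xᵢ + xⱼ for coordinates u = xᵢ, v = xⱼ (i < j).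
pairWalls : ℤ → ℤ → ℕ
pairWalls u v = walls (u ℤ.- v) + walls (u ℤ.+ v)

rowWalls : ℤ → List ℤ → ℕ
rowWalls u []      = 0
rowWalls u (v ∷ r) = pairWalls u v + rowWalls u r

-- The potential of a point: the number of walls of all roots 2xᵢ, xᵢ ± xⱼ crossed on the way
-- from the fundamental alcove; it plays the role of the length function on the orbit of 0.
potential : List ℤ → ℕ
potential []      = 0
potential (u ∷ r) = walls (u ℤ.+ u) + rowWalls u r + potential r

walls-1- : ∀ t → walls (1ℤ ℤ.- t) ≡ walls t
walls-1- (ℤ.+ zero)        = refl
walls-1- (ℤ.+ suc zero)    = refl
walls-1- (ℤ.+ suc (suc k)) = refl
walls-1- -[1+ k ]        = refl

-- The pair terms are invariant under x₁ ↦ 1 − x₁ and under xⱼ ↦ −xⱼ, since these permute the walls.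
pairWalls-1- : ∀ u v → pairWalls (1ℤ ℤ.- u) v ≡ pairWalls u v
pairWalls-1- u v = begin
  walls ((1ℤ ℤ.- u) ℤ.- v) + walls ((1ℤ ℤ.- u) ℤ.+ v)   ≡⟨ cong₂ _+_ (cong walls (e₁ u v)) (cong walls (e₂ u v)) ⟩
  walls (1ℤ ℤ.- (u ℤ.+ v)) + walls (1ℤ ℤ.- (u ℤ.- v))   ≡⟨ cong₂ _+_ (walls-1- (u ℤ.+ v)) (walls-1- (u ℤ.- v)) ⟩
  walls (u ℤ.+ v) + walls (u ℤ.- v)                     ≡⟨ ℕₚ.+-comm (walls (u ℤ.+ v)) _ ⟩
  pairWalls u v                                         ∎
  where
  open ≡-Reasoning
  e₁ : ∀ u v → (1ℤ ℤ.- u) ℤ.- v ≡ 1ℤ ℤ.- (u ℤ.+ v)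
  e₁ = solve-∀
  e₂ : ∀ u v → (1ℤ ℤ.- u) ℤ.+ v ≡ 1ℤ ℤ.- (u ℤ.- v)
  e₂ = solve-∀

pairWalls-neg : ∀ u v → pairWalls u (ℤ.- v) ≡ pairWalls u v
pairWalls-neg u v = begin
  walls (u ℤ.- ℤ.- v) + walls (u ℤ.+ ℤ.- v)   ≡⟨ cong (λ t → walls (u ℤ.+ t) + walls (u ℤ.- v)) (ℤₚ.neg-involutive v) ⟩
  walls (u ℤ.+ v) + walls (u ℤ.- v)           ≡⟨ ℕₚ.+-comm (walls (u ℤ.+ v)) _ ⟩
  pairWalls u v                               ∎
  where open ≡-Reasoning

rowWalls-1- : ∀ u r → rowWalls (1ℤ ℤ.- u) r ≡ rowWalls u r
rowWalls-1- u []      = refl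
rowWalls-1- u (v ∷ r) = cong₂ _+_ (pairWalls-1- u v) (rowWalls-1- u r)

-- A row sum only sees the multiset of coordinates up to sign.
rowWalls-reflectAt : ∀ i u r → rowWalls u (reflectAt i r) ≡ rowWalls u r
rowWalls-reflectAt zero    u []          = refl
rowWalls-reflectAt zero    u (v ∷ [])    = cong (_+ 0) (pairWalls-neg u v)
rowWalls-reflectAt zero    u (v ∷ w ∷ r) = begin
  pairWalls u w + (pairWalls u v + rowWalls u r)   ≡⟨ ℕₚ.+-assoc (pairWalls u w) _ _ ⟨
  pairWalls u w + pairWalls u v + rowWalls u r     ≡⟨ cong (_+ rowWalls u r) (ℕₚ.+-comm (pairWalls u w) _) ⟩
  pairWalls u v + pairWalls u w + rowWalls u r     ≡⟨ ℕₚ.+-assoc (pairWalls u v) _ _ ⟩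
  pairWalls u v + (pairWalls u w + rowWalls u r)   ∎
  where open ≡-Reasoning
rowWalls-reflectAt (suc i) u []          = refl
rowWalls-reflectAt (suc i) u (v ∷ r)     = cong (pairWalls u v +_) (rowWalls-reflectAt i u r)

-- s_a is an ascent at x when x lies strictly on the positive side of the wall of s_a:
-- x₁ ≤ 0 for s₀ (which is the wall x₁ = ½), xᵢ₊₁ < xᵢ for sᵢ, and xₙ > 0 for sₙ.
AscentAt : ℕ → List ℤ → Set
AscentAt zero    []          = ⊥
AscentAt zero    (u ∷ [])    = 0ℤ ℤ.< u
AscentAt zero    (u ∷ v ∷ r) = v ℤ.< u
AscentAt (suc i) []          = ⊥
AscentAt (suc i) (u ∷ r)     = AscentAt i r

Ascent : ℕ → List ℤ → Set
Ascent zero    []      = ⊥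
Ascent zero    (u ∷ r) = u ℤ.≤ 0ℤ
Ascent (suc i) x       = AscentAt i x

walls-neg : ∀ t → 0ℤ ℤ.< t → walls (ℤ.- t) ≡ suc (walls t)
walls-neg (ℤ.+ suc k) _            = refl
walls-neg (ℤ.+ zero)  (ℤ.+<+ ())

walls-flip : ∀ u v → v ℤ.< u → walls (v ℤ.- u) ≡ suc (walls (u ℤ.- v))
walls-flip u v v<u = trans (cong walls (e u v)) (walls-neg (u ℤ.- v) 0<u-v)
  where
  0<u-v : 0ℤ ℤ.< u ℤ.- v
  0<u-v = subst (ℤ._< u ℤ.- v) (ℤₚ.+-inverseʳ v) (ℤₚ.+-monoˡ-< (ℤ.- v) v<u)
  e : ∀ u v → v ℤ.- u ≡ ℤ.- (u ℤ.- v)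
  e = solve-∀

potential-swap : ∀ u v r → v ℤ.< u → potential (v ∷ u ∷ r) ≡ suc (potential (u ∷ v ∷ r))
potential-swap u v r v<u rewrite walls-flip u v v<u | ℤₚ.+-comm v u =
  count (walls (u ℤ.+ u)) (walls (v ℤ.+ v)) (rowWalls u r) (rowWalls v r) (potential r)
        (walls (u ℤ.- v)) (walls (u ℤ.+ v))
  where
  count : ∀ X Y P Q E A B → Y + ((suc A + B) + Q) + (X + P + E) ≡ suc (X + ((A + B) + P) + (Y + Q + E))
  count = NS.solve-∀

potential-negate : ∀ u → 0ℤ ℤ.< u → potential (ℤ.- u ∷ []) ≡ suc (potential (u ∷ []))
potential-negate (ℤ.+ suc k) _ rewrite ℕₚ.+-suc k k = refl
potential-negate (ℤ.+ zero)  (ℤ.+<+ ())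

potential-reflect₀ : ∀ u r → u ℤ.≤ 0ℤ → potential (reflect₀ (u ∷ r)) ≡ suc (potential (u ∷ r))
potential-reflect₀ (ℤ.+ zero) r _ rewrite rowWalls-1- (ℤ.+ 0) r = refl
potential-reflect₀ -[1+ k ] r _ rewrite rowWalls-1- -[1+ k ] r | ℕₚ.+-suc k (suc k) | ℕₚ.+-suc k k = refl
potential-reflect₀ (ℤ.+ suc k) r (ℤ.+≤+ ())

potential-ascent : ∀ a x → Ascent a x → potential (reflect a x) ≡ suc (potential x)
potential-ascent zero    (u ∷ r) u≤0 = potential-reflect₀ u r u≤0
potential-ascent (suc i) x       asc = go i x asc
  where
  go : ∀ i x → AscentAt i x → potential (reflectAt i x) ≡ suc (potential x)
  go zero    (u ∷ [])    asc = potential-negate u asc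
  go zero    (u ∷ v ∷ r) asc = potential-swap u v r asc
  go (suc i) (u ∷ r)     asc rewrite rowWalls-reflectAt i u r | go i r asc = ℕₚ.+-suc _ (potential r)

ascent-trichotomy : ∀ a x → Ascent a x ⊎ Ascent a (reflect a x) ⊎ reflect a x ≡ x
ascent-trichotomy zero    []                    = inj₂ (inj₂ refl)
ascent-trichotomy zero    (ℤ.+ zero ∷ r)        = inj₁ (ℤ.+≤+ z≤n)
ascent-trichotomy zero    (ℤ.+ suc zero ∷ r)      = inj₂ (inj₁ (ℤ.+≤+ z≤n))
ascent-trichotomy zero    (ℤ.+ suc (suc k) ∷ r)   = inj₂ (inj₁ ℤ.-≤+)
ascent-trichotomy zero    (-[1+ k ] ∷ r)        = inj₁ ℤ.-≤+
ascent-trichotomy (suc i) x                     = go i x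
  where
  go : ∀ i x → AscentAt i x ⊎ AscentAt i (reflectAt i x) ⊎ reflectAt i x ≡ x
  go zero    []          = inj₂ (inj₂ refl)
  go zero    (u ∷ [])    with ℤₚ.<-cmp 0ℤ u
  ... | tri< 0<u _ _    = inj₁ 0<u
  ... | tri≈ _ refl _   = inj₂ (inj₂ refl)
  ... | tri> _ _ u<0    = inj₂ (inj₁ (ℤₚ.neg-mono-< u<0))
  go zero    (u ∷ v ∷ r) with ℤₚ.<-cmp v u
  ... | tri< v<u _ _    = inj₁ v<u
  ... | tri≈ _ refl _   = inj₂ (inj₂ refl)
  ... | tri> _ _ u<v    = inj₂ (inj₁ u<v)
  go (suc i) []          = inj₂ (inj₂ refl)
  go (suc i) (u ∷ r)     = Sum.map₂ (Sum.map₂ (cong (u ∷_))) (go i r)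

potential-reflect-≤ : ∀ a x → potential (reflect a x) ≤ suc (potential x)
potential-reflect-≤ a x with ascent-trichotomy a x
... | inj₁ asc        = ℕₚ.≤-reflexive (potential-ascent a x asc)
... | inj₂ (inj₂ fix) = subst (λ y → potential y ≤ suc (potential x)) (sym fix) (ℕₚ.n≤1+n _)
... | inj₂ (inj₁ asc) = ℕₚ.≤-trans (ℕₚ.n≤1+n _) (ℕₚ.≤-trans (ℕₚ.≤-reflexive back) (ℕₚ.n≤1+n _))
  where
  back : suc (potential (reflect a x)) ≡ potential x
  back = trans (sym (potential-ascent a (reflect a x) asc)) (cong potential (reflect-involutive a x))

potential-act-≤ : ∀ w x → potential (act w x) ≤ length w + potential x
potential-act-≤ []      x = ℕₚ.≤-refl
potential-act-≤ (a ∷ w) x = ℕₚ.≤-trans (potential-reflect-≤ a (act w x)) (s≤s (potential-act-≤ w x))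

Ascending : List ℕ → List ℤ → Set
Ascending []      x = ⊤
Ascending (a ∷ w) x = Ascending w x × Ascent a (act w x)

potential-ascending : ∀ w x → Ascending w x → potential (act w x) ≡ length w + potential x
potential-ascending []      x _           = refl
potential-ascending (a ∷ w) x (asc , a↑) = trans (potential-ascent a (act w x) a↑) (cong suc (potential-ascending w x asc))

ascending-++ : ∀ u v x → Ascending v x → Ascending u (act v x) → Ascending (u ++ v) x
ascending-++ []      v x v↑ _           = v↑
ascending-++ (a ∷ u) v x v↑ (u↑ , a↑) =
  ascending-++ u v x v↑ u↑ , subst (Ascent a) (sym (act-++ u v x)) a↑

origin : ℕ → List ℤ
origin n = replicate n 0ℤ

length-origin : ∀ n → length (origin n) ≡ n
length-origin n = length-replicate n

potential-origin : ∀ n → potential (origin n) ≡ 0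
potential-origin zero    = refl
potential-origin (suc n) rewrite potential-origin n = rowWalls-0 n
  where
  rowWalls-0 : ∀ n → rowWalls 0ℤ (origin n) + 0 ≡ 0
  rowWalls-0 zero    = refl
  rowWalls-0 (suc n) = rowWalls-0 n

reflectAt-origin : ∀ i n → reflectAt i (origin n) ≡ origin n
reflectAt-origin zero    zero          = refl
reflectAt-origin zero    (suc zero)    = refl
reflectAt-origin zero    (suc (suc n)) = refl
reflectAt-origin (suc i) zero          = refl
reflectAt-origin (suc i) (suc n)       = cong (0ℤ ∷_) (reflectAt-origin i n)

SWord-fixes-origin : ∀ {n} (u : Word n) m → SWord u → actWord u (origin m) ≡ origin m
SWord-fixes-origin []             m _            = refl
SWord-fixes-origin (Fin.zero ∷ u)  m (s≢0 ∷ _)    = ⊥-elim (s≢0 refl)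
SWord-fixes-origin (Fin.suc s ∷ u) m (_ ∷ u∈W_S)
  rewrite SWord-fixes-origin u m u∈W_S = reflectAt-origin (toℕ s) m

potential-≤-length : ∀ {n} → 2 ≤ n → (v w : Word n) → v ≈ w → potential (actWord w (origin n)) ≤ length v
potential-≤-length {n} 2≤n v w v≈w = begin
  potential (actWord w (origin n))               ≡⟨ cong potential (act-respects-≈ 2≤n v≈w (origin n) (length-origin n)) ⟨
  potential (actWord v (origin n))               ≤⟨ potential-act-≤ (map toℕ v) (origin n) ⟩
  length (map toℕ v) + potential (origin n)      ≡⟨ cong₂ _+_ (length-map toℕ v) (potential-origin n) ⟩
  length v + 0                                   ≡⟨ ℕₚ.+-identityʳ (length v) ⟩
  length v                                       ∎
  where open ℕₚ.≤-Reasoning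

-- The length criterion: if the potential of w·0 equals |w|, then w is reduced, and it is of
-- minimal length in its coset w W_S, since w u·0 = w·0 for every u ∈ W_S.
potential-criterion : ∀ {n} → 2 ≤ n → (w : Word n) → potential (actWord w (origin n)) ≡ length w →
  InWS w × HasLength w (length w)
potential-criterion {n} 2≤n w pot≡len = minimal , (w , ≈-refl , refl) , lower
  where
  lower : ∀ v → v ≈ w → length w ≤ length v
  lower v v≈w = subst (_≤ length v) pot≡len (potential-≤-length 2≤n v w v≈w)
  minimal : InWS w
  minimal u u∈W_S v v≈wu = w , ≈-refl , subst (_≤ length v) pot≡len
    (subst (λ y → potential y ≤ length v)
      (trans (actWord-++ w u (origin n)) (cong (actWord w) (SWord-fixes-origin u n u∈W_S)))
      (potential-≤-length 2≤n v (w ++ u) v≈wu))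

toℕ-gen-word : ∀ n l → All (_≤ n) l → map toℕ (map (gen n) l) ≡ l
toℕ-gen-word n []      []         = refl
toℕ-gen-word n (a ∷ l) (a≤n ∷ l≤n) = cong₂ _∷_ (toℕ-gen n a a≤n) (toℕ-gen-word n l l≤n)

ascending⇒minimal : ∀ n → 2 ≤ n → ∀ l → All (_≤ n) l → Ascending l (origin n) →
  InWS (map (gen n) l) × HasLength (map (gen n) l) (length l)
ascending⇒minimal n 2≤n l l≤n l↑ =
  subst (λ L → InWS (map (gen n) l) × HasLength (map (gen n) l) L) (length-map (gen n) l)
    (potential-criterion 2≤n (map (gen n) l) (begin
      potential (act (map toℕ (map (gen n) l)) (origin n))   ≡⟨ cong (λ l′ → potential (act l′ (origin n))) (toℕ-gen-word n l l≤n) ⟩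
      potential (act l (origin n))                           ≡⟨ potential-ascending l (origin n) l↑ ⟩
      length l + potential (origin n)                        ≡⟨ cong (length l +_) (potential-origin n) ⟩
      length l + 0                                           ≡⟨ ℕₚ.+-identityʳ (length l) ⟩
      length l                                               ≡⟨ length-map (gen n) l ⟨
      length (map (gen n) l)                                 ∎))
  where open ≡-Reasoning

shorter-in-coset : ∀ {n} (w u v : Word n) {L} → SWord u → v ≈ (w ++ u) → length v < L →
  InWS w → HasLength w L → ⊥
shorter-in-coset w u v u∈W_S v≈wu |v|<L minimal (_ , lower) with minimal u u∈W_S v v≈wu
... | x , x≈w , |x|≤|v| = ℕₚ.<⇒≱ |v|<L (ℕₚ.≤-trans (lower x x≈w) |x|≤|v|)

-- Index notation for runs of generators:
-- down b l = [b+l−1, …, b+1, b] spells s_{b+l−1} ⋯ s_b, and up a c = [a, …, a+c−1] spells s_a ⋯ s_{a+c−1}.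
down : ℕ → ℕ → List ℕ
down b zero    = []
down b (suc l) = (b + l) ∷ down b l

up : ℕ → ℕ → List ℕ
up a zero    = []
up a (suc c) = a ∷ up (suc a) c

length-down : ∀ b l → length (down b l) ≡ l
length-down b zero    = refl
length-down b (suc l) = cong suc (length-down b l)

length-up : ∀ a c → length (up a c) ≡ c
length-up a zero    = refl
length-up a (suc c) = cong suc (length-up (suc a) c)

down-+ : ∀ b x y → down b (x + y) ≡ down (b + x) y ++ down b x
down-+ b x zero    = cong (down b) (ℕₚ.+-identityʳ x)
down-+ b x (suc y) = trans (cong (down b) (ℕₚ.+-suc x y)) (cong₂ _∷_ (sym (ℕₚ.+-assoc b x y)) (down-+ b x y))

down-snoc : ∀ b l → down b (suc l) ≡ down (suc b) l ++ b ∷ []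
down-snoc b zero    = cong (_∷ []) (ℕₚ.+-identityʳ b)
down-snoc b (suc l) = cong₂ _∷_ (ℕₚ.+-suc b l) (down-snoc b l)

map-suc-down : ∀ b l → map suc (down b l) ≡ down (suc b) l
map-suc-down b zero    = refl
map-suc-down b (suc l) = cong (suc (b + l) ∷_) (map-suc-down b l)

up-+ : ∀ a x y → up a (x + y) ≡ up a x ++ up (a + x) y
up-+ a zero    y = cong (λ a′ → up a′ y) (sym (ℕₚ.+-identityʳ a))
up-+ a (suc x) y = cong (a ∷_) (trans (up-+ (suc a) x y) (cong (λ a′ → up (suc a) x ++ up a′ y) (sym (ℕₚ.+-suc a x))))

down-bounds : ∀ b l → All (λ x → b ≤ x × x < b + l) (down b l)
down-bounds b zero    = []
down-bounds b (suc l) = (ℕₚ.m≤m+n b l , ℕₚ.+-monoʳ-< b (ℕₚ.n<1+n l))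
  ∷ All.map (Prod.map₂ (λ x< → ℕₚ.<-trans x< (ℕₚ.+-monoʳ-< b (ℕₚ.n<1+n l)))) (down-bounds b l)

up-bounds : ∀ a c → All (λ x → a ≤ x × x < a + c) (up a c)
up-bounds a zero    = []
up-bounds a (suc c) = (ℕₚ.≤-refl , ℕₚ.m<m+n a (s≤s z≤n))
  ∷ All.map (λ { {x} (a<x , x<) → ℕₚ.<⇒≤ a<x , subst (x <_) (sym (ℕₚ.+-suc a c)) x< }) (up-bounds (suc a) c)

-- The two shapes of the segment σ(j), 1 ≤ j ≤ 2n, where n = m + 1:  for j ≤ n it is the
-- descending run s_{j−1} ⋯ s₀, and for j = n + 1 + c (c ≤ m) it is the climb s_{p+1} ⋯ s_{n−1}
-- (p + c = m) followed by the full run s_n ⋯ s₀.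
data Shape (m : ℕ) : ℕ → Set where
  descending : ∀ a → a ≤ m → Shape m (suc a)
  returning  : ∀ p c → p + c ≡ m → Shape m (suc (suc m) + c)

shape : ∀ m j → 1 ≤ j → j ≤ 2 * suc m → Shape m j
shape m (suc a) _ j≤2n with a ≤? m
... | yes a≤m = descending a a≤m
... | no  a≰m = subst (Shape m) j≡ (returning (m ∸ c) c (ℕₚ.m∸n+n≡m c≤m))
  where
  c : ℕ
  c = a ∸ suc m
  j≡ : suc (suc m) + c ≡ suc a
  j≡ = cong suc (ℕₚ.m+[n∸m]≡n (ℕₚ.≰⇒> a≰m))
  2n≡ : 2 * suc m ≡ suc (suc m) + m
  2n≡ = double m
    where
    double : ∀ m → 2 * suc m ≡ suc (suc m) + m
    double = NS.solve-∀
  c≤m : c ≤ m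
  c≤m = ℕₚ.+-cancelˡ-≤ (suc (suc m)) c m (subst₂ _≤_ (sym j≡) 2n≡ j≤2n)

downFrom-down : ∀ l → downFrom l ≡ down 0 l
downFrom-down zero    = refl
downFrom-down (suc l) = cong (l ∷_) (downFrom-down l)

≤⇒≤ᵇ-true : ∀ {j k} → j ≤ k → (j ≤ᵇ k) ≡ true
≤⇒≤ᵇ-true j≤k = Equivalence.to T-≡ (ℕₚ.≤⇒≤ᵇ j≤k)

≰⇒≤ᵇ-false : ∀ {j k} → ¬ (j ≤ k) → (j ≤ᵇ k) ≡ false
≰⇒≤ᵇ-false {j} {k} j≰k = ¬-not (λ eq → j≰k (ℕₚ.≤ᵇ⇒≤ j k (Equivalence.from T-≡ eq)))

σ-descending : ∀ m a → a ≤ suc m → σℕ (suc m) (suc a) ≡ down 0 (suc a)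
σ-descending m a a≤n rewrite ≤⇒≤ᵇ-true (s≤s a≤n) = downFrom-down (suc a)

σ-returning : ∀ m p c → p + c ≡ m → σℕ (suc m) (suc (suc m) + c) ≡ up (suc p) c ++ down 0 (suc (suc m))
σ-returning m p zero    _ = subst (λ j → σℕ (suc m) j ≡ down 0 (suc (suc m)))
  (sym (ℕₚ.+-identityʳ (suc (suc m)))) (σ-descending m (suc m) ℕₚ.≤-refl)
σ-returning m p (suc r) p+c≡m
  rewrite ≰⇒≤ᵇ-false {suc (suc m) + suc r} {suc (suc m)} (λ j≤n → ℕₚ.<-irrefl refl (ℕₚ.<-≤-trans (ℕₚ.m<m+n (suc (suc m)) (s≤s z≤n)) j≤n))
        | ℕₚ.m+n∸m≡n (suc (suc m)) (suc r) =
  cong₂ _++_ (applyUpTo-up (λ i → trans (cong (λ q → q + 1 + i) start) (cong (_+ i) (ℕₚ.+-comm p 1))) (suc r))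
             (cong (suc m ∷_) (downFrom-down (suc m)))
  where
  start : 2 * suc m ∸ (suc (suc m) + suc r) ≡ p
  start = begin
    2 * suc m ∸ (suc (suc m) + suc r)                  ≡⟨ cong (λ m′ → 2 * suc m′ ∸ (suc (suc m′) + suc r)) (sym p+c≡m) ⟩
    2 * suc (p + suc r) ∸ (suc (suc (p + suc r)) + suc r) ≡⟨ cong (_∸ (suc (suc (p + suc r)) + suc r)) (e p r) ⟩
    (suc (suc (p + suc r)) + suc r) + p ∸ (suc (suc (p + suc r)) + suc r) ≡⟨ ℕₚ.m+n∸m≡n (suc (suc (p + suc r)) + suc r) p ⟩
    p                                                   ∎
    where
    open ≡-Reasoning
    e : ∀ p r → 2 * suc (p + suc r) ≡ (suc (suc (p + suc r)) + suc r) + p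
    e = NS.solve-∀
  applyUpTo-up : ∀ {f : ℕ → ℕ} {q} → (∀ i → f i ≡ q + i) → ∀ c → applyUpTo f c ≡ up q c
  applyUpTo-up         f≡ zero    = refl
  applyUpTo-up {q = q} f≡ (suc c) = cong₂ _∷_ (trans (f≡ 0) (ℕₚ.+-identityʳ q))
    (applyUpTo-up (λ i → trans (f≡ (suc i)) (ℕₚ.+-suc q i)) c)

length-σ : ∀ {m j} → Shape m j → length (σℕ (suc m) j) ≡ j
length-σ {m} (descending a a≤m) = trans (cong length (σ-descending m a (ℕₚ.m≤n⇒m≤1+n a≤m))) (length-down 0 (suc a))
length-σ {m} (returning p c eq) = begin
  length (σℕ (suc m) (suc (suc m) + c))                ≡⟨ cong length (σ-returning m p c eq) ⟩
  length (up (suc p) c ++ down 0 (suc (suc m)))        ≡⟨ length-++ (up (suc p) c) ⟩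
  length (up (suc p) c) + length (down 0 (suc (suc m))) ≡⟨ cong₂ _+_ (length-up (suc p) c) (length-down 0 (suc (suc m))) ⟩
  c + suc (suc m)                                      ≡⟨ ℕₚ.+-comm c (suc (suc m)) ⟩
  suc (suc m) + c                                      ∎
  where open ≡-Reasoning

σ-letters : ∀ {m j} → Shape m j → All (_≤ suc m) (σℕ (suc m) j)
σ-letters {m} (descending a a≤m) rewrite σ-descending m a (ℕₚ.m≤n⇒m≤1+n a≤m) =
  All.map (λ (_ , x<) → ℕₚ.≤-trans (ℕₚ.≤-pred x<) (ℕₚ.m≤n⇒m≤1+n a≤m)) (down-bounds 0 (suc a))
σ-letters {m} (returning p c eq) rewrite σ-returning m p c eq =
  AllP.++⁺ (All.map (λ { {x} (_ , x<) → ℕₚ.<⇒≤ (subst (x <_) (cong suc eq) x<) }) (up-bounds (suc p) c))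
           (All.map (λ (_ , x<) → ℕₚ.≤-pred x<) (down-bounds 0 (suc (suc m))))

Walk : List ℕ → List ℤ → List ℤ → Set
Walk w x y = act w x ≡ y × Ascending w x

walk-++ : ∀ {u v x y z} → Walk v x y → Walk u y z → Walk (u ++ v) x z
walk-++ {u} {v} {x} (refl , v↑) (refl , u↑) = act-++ u v x , ascending-++ u v x v↑ u↑

swap-step : ∀ A u v y → v ℤ.< u → Walk (suc (length A) ∷ []) (A ++ u ∷ v ∷ y) (A ++ v ∷ u ∷ y)
swap-step []      u v y v<u = refl , tt , v<u
swap-step (a ∷ A) u v y v<u = Prod.map₁ (cong (a ∷_)) (swap-step A u v y v<u)

negate-step : ∀ A u → 0ℤ ℤ.< u → Walk (suc (length A) ∷ []) (A ++ u ∷ []) (A ++ ℤ.- u ∷ [])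
negate-step []      u 0<u = refl , tt , 0<u
negate-step (a ∷ A) u 0<u = Prod.map₁ (cong (a ∷_)) (negate-step A u 0<u)

reflect₀-step : ∀ h t → h ℤ.≤ 0ℤ → Walk (0 ∷ []) (h ∷ t) ((1ℤ ℤ.- h) ∷ t)
reflect₀-step h t h≤0 = refl , tt , h≤0

length-snoc : ∀ (A : List ℤ) b → length (A ++ [ b ]) ≡ suc (length A)
length-snoc A b = trans (length-++ A) (ℕₚ.+-comm (length A) 1)

carry-right : ∀ A v B C → All (ℤ._< v) B → Walk (down (suc (length A)) (length B)) (A ++ v ∷ B ++ C) (A ++ B ++ v ∷ C)
carry-right A v []      C []           = refl , tt
carry-right A v (b ∷ B) C (b<v ∷ B<v) =
  subst (λ w → Walk w (A ++ v ∷ b ∷ B ++ C) (A ++ b ∷ B ++ v ∷ C)) (sym (down-snoc (suc (length A)) (length B)))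
    (walk-++ (swap-step A v b (B ++ C) b<v)
      (subst₂ (λ L X → Walk (down (suc L) (length B)) X (A ++ b ∷ B ++ v ∷ C)) (length-snoc A b) (++-assoc A [ b ] _)
        (subst (Walk (down (suc (length (A ++ [ b ]))) (length B)) ((A ++ [ b ]) ++ v ∷ B ++ C)) (++-assoc A [ b ] _)
          (carry-right (A ++ [ b ]) v B C B<v))))

carry-left : ∀ A B v C → All (v ℤ.<_) B → Walk (up (suc (length A)) (length B)) (A ++ B ++ v ∷ C) (A ++ v ∷ B ++ C)
carry-left A []      v C []           = refl , tt
carry-left A (b ∷ B) v C (v<b ∷ v<B) =
  walk-++ {u = suc (length A) ∷ []}
    (subst₂ (λ L X → Walk (up (suc L) (length B)) X (A ++ b ∷ v ∷ B ++ C)) (length-snoc A b) (++-assoc A [ b ] _)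
      (subst (Walk (up (suc (length (A ++ [ b ]))) (length B)) ((A ++ [ b ]) ++ B ++ v ∷ C)) (++-assoc A [ b ] _)
        (carry-left (A ++ [ b ]) B v C v<B)))
    (swap-step A b v (B ++ C) v<b)

1-h-pos : ∀ h → h ℤ.≤ 0ℤ → 0ℤ ℤ.< 1ℤ ℤ.- h
1-h-pos (ℤ.+ zero) _ = ℤ.+<+ (s≤s z≤n)
1-h-pos -[1+ k ]   _ = ℤ.+<+ (s≤s z≤n)
1-h-pos (ℤ.+ suc k) (ℤ.+≤+ ())

nonpositive<1-h : ∀ {h x} → h ℤ.≤ 0ℤ → x ℤ.≤ 0ℤ → x ℤ.< 1ℤ ℤ.- h
nonpositive<1-h {h} h≤0 x≤0 = ℤₚ.≤-<-trans x≤0 (1-h-pos h h≤0)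

walk-descending : ∀ h T₁ T₂ → h ℤ.≤ 0ℤ → All (ℤ._< 1ℤ ℤ.- h) T₁ →
  Walk (down 0 (suc (length T₁))) (h ∷ T₁ ++ T₂) (T₁ ++ (1ℤ ℤ.- h) ∷ T₂)
walk-descending h T₁ T₂ h≤0 T₁< =
  subst (λ w → Walk w (h ∷ T₁ ++ T₂) (T₁ ++ (1ℤ ℤ.- h) ∷ T₂)) (sym (down-snoc 0 (length T₁)))
    (walk-++ (reflect₀-step h (T₁ ++ T₂) h≤0) (carry-right [] (1ℤ ℤ.- h) T₁ T₂ T₁<))

walk-full : ∀ h t → h ℤ.≤ 0ℤ → All (ℤ._< 1ℤ ℤ.- h) t →
  Walk (down 0 (suc (suc (length t)))) (h ∷ t) (t ++ ℤ.- (1ℤ ℤ.- h) ∷ [])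
walk-full h t h≤0 t< =
  walk-++ {u = suc (length t) ∷ []} {v = down 0 (suc (length t))}
    (subst (λ x → Walk (down 0 (suc (length t))) (h ∷ x) (t ++ (1ℤ ℤ.- h) ∷ [])) (++-identityʳ t)
      (walk-descending h t [] h≤0 t<))
    (negate-step t (1ℤ ℤ.- h) (1-h-pos h h≤0))

walk-returning : ∀ h T₁ T₂ → h ℤ.≤ 0ℤ → All (ℤ._< 1ℤ ℤ.- h) (T₁ ++ T₂) → All (ℤ.- (1ℤ ℤ.- h) ℤ.<_) T₂ →
  Walk (up (suc (length T₁)) (length T₂) ++ down 0 (suc (suc (length (T₁ ++ T₂)))))
       (h ∷ T₁ ++ T₂) (T₁ ++ ℤ.- (1ℤ ℤ.- h) ∷ T₂)
walk-returning h T₁ T₂ h≤0 T< v<T₂ =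
  walk-++ (walk-full h (T₁ ++ T₂) h≤0 T<)
    (subst₂ (Walk (up (suc (length T₁)) (length T₂))) (sym (++-assoc T₁ T₂ _))
      (cong (λ y → T₁ ++ ℤ.- (1ℤ ℤ.- h) ∷ y) (++-identityʳ T₂))
      (carry-left T₁ T₂ (ℤ.- (1ℤ ℤ.- h)) [] v<T₂))

origin-+ : ∀ a b → origin (a + b) ≡ origin a ++ origin b
origin-+ zero    b = refl
origin-+ (suc a) b = cong (0ℤ ∷_) (origin-+ a b)

σ-from-origin-descending : ∀ m a → a ≤ m →
  Walk (σℕ (suc m) (suc a)) (origin (suc m)) (origin a ++ 1ℤ ∷ origin (m ∸ a))
σ-from-origin-descending m a a≤m =
  subst₂ (λ w x → Walk w x (origin a ++ 1ℤ ∷ origin (m ∸ a)))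
    (trans (cong (λ l → down 0 (suc l)) (length-origin a)) (sym (σ-descending m a (ℕₚ.m≤n⇒m≤1+n a≤m))))
    (cong (0ℤ ∷_) (trans (sym (origin-+ a (m ∸ a))) (cong origin (ℕₚ.m+[n∸m]≡n a≤m))))
    (walk-descending 0ℤ (origin a) (origin (m ∸ a)) (ℤ.+≤+ z≤n) (AllP.replicate⁺ a (ℤ.+<+ (s≤s z≤n))))

σ-from-origin-returning : ∀ m p c → p + c ≡ m →
  Walk (σℕ (suc m) (suc (suc m) + c)) (origin (suc m)) (origin p ++ -[1+ 0 ] ∷ origin c)
σ-from-origin-returning m p c p+c≡m =
  subst₂ (λ w x → Walk w x (origin p ++ -[1+ 0 ] ∷ origin c))
    (trans (cong₂ (λ a l → up (suc a) l ++ down 0 (suc (suc (length (origin p ++ origin c))))) (length-origin p) (length-origin c))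
      (trans (cong (λ l → up (suc p) c ++ down 0 (suc (suc l))) ≡m) (sym (σ-returning m p c p+c≡m))))
    (cong (0ℤ ∷_) (trans (sym (origin-+ p c)) (cong origin p+c≡m)))
    (walk-returning 0ℤ (origin p) (origin c) (ℤ.+≤+ z≤n)
      (subst (All _) (origin-+ p c) (AllP.replicate⁺ (p + c) (ℤ.+<+ (s≤s z≤n))))
      (AllP.replicate⁺ c ℤ.-<+))
  where
  ≡m : length (origin p ++ origin c) ≡ m
  ≡m = trans (cong length (sym (origin-+ p c))) (trans (length-origin (p + c)) p+c≡m)

σ-ascends-from-unit : ∀ m a b → b < a → a ≤ m → Ascending (σℕ (suc m) (suc b)) (origin a ++ 1ℤ ∷ origin (m ∸ a))
σ-ascends-from-unit m (suc a) b (s≤s b≤a) a≤m =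
  subst₂ Ascending
    (trans (cong (λ l → down 0 (suc l)) (length-origin b)) (sym (σ-descending m b (ℕₚ.≤-trans b≤a (ℕₚ.≤-trans (ℕₚ.n≤1+n a) (ℕₚ.m≤n⇒m≤1+n a≤m))))))
    (cong (0ℤ ∷_) (trans (sym (++-assoc (origin b) (origin (a ∸ b)) X))
      (cong (_++ X) (trans (sym (origin-+ b (a ∸ b))) (cong origin (ℕₚ.m+[n∸m]≡n b≤a))))))
    (proj₂ (walk-descending 0ℤ (origin b) (origin (a ∸ b) ++ X) (ℤ.+≤+ z≤n) (AllP.replicate⁺ b (ℤ.+<+ (s≤s z≤n)))))
  where
  X : List ℤ
  X = 1ℤ ∷ origin (m ∸ suc a)

σ-ascends-descending : ∀ m b h t → b ≤ m → length t ≡ m → h ℤ.≤ 0ℤ → All (ℤ._≤ 0ℤ) t →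
  Ascending (σℕ (suc m) (suc b)) (h ∷ t)
σ-ascends-descending m b h t b≤m |t|≡m h≤0 t≤0 =
  subst₂ (λ w x → Ascending w (h ∷ x))
    (trans (cong (λ l → down 0 (suc l)) (trans (length-take b t) (ℕₚ.m≤n⇒m⊓n≡m (subst (b ≤_) (sym |t|≡m) b≤m))))
      (sym (σ-descending m b (ℕₚ.m≤n⇒m≤1+n b≤m))))
    (take++drop≡id b t)
    (proj₂ (walk-descending h (take b t) (drop b t) h≤0 (AllP.take⁺ b (All.map (nonpositive<1-h h≤0) t≤0))))

σ-ascends-returning : ∀ m p c h U → p + c ≡ m → length U ≡ p → h ℤ.≤ 0ℤ → All (ℤ._≤ 0ℤ) U →
  Ascending (σℕ (suc m) (suc (suc m) + c)) (h ∷ U ++ origin c)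
σ-ascends-returning m p c h U p+c≡m |U|≡p h≤0 U≤0 =
  subst (λ w → Ascending w (h ∷ U ++ origin c))
    (trans (cong₂ (λ a l → up (suc a) l ++ down 0 (suc (suc (length (U ++ origin c))))) |U|≡p (length-origin c))
      (trans (cong (λ l → up (suc p) c ++ down 0 (suc (suc l))) ≡m) (sym (σ-returning m p c p+c≡m))))
    (proj₂ (walk-returning h U (origin c) h≤0
      (AllP.++⁺ (All.map (nonpositive<1-h h≤0) U≤0) (AllP.replicate⁺ c (1-h-pos h h≤0)))
      (AllP.replicate⁺ c (ℤₚ.neg-mono-< (1-h-pos h h≤0)))))
  where
  ≡m : length (U ++ origin c) ≡ m
  ≡m = trans (length-++ U) (trans (cong₂ _+_ |U|≡p (length-origin c)) p+c≡m)

sink-form : ∀ p c → Σ ℤ λ h → Σ (List ℤ) λ U →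
  (origin p ++ -[1+ 0 ] ∷ origin c ≡ h ∷ U ++ origin c) × h ℤ.≤ 0ℤ × All (ℤ._≤ 0ℤ) U × length U ≡ p
sink-form zero    c = -[1+ 0 ] , [] , refl , ℤ.-≤+ , [] , refl
sink-form (suc p) c = 0ℤ , origin p ++ [ -[1+ 0 ] ] , cong (0ℤ ∷_) (sym (++-assoc (origin p) _ (origin c))) ,
  ℤ.+≤+ z≤n , AllP.++⁺ (AllP.replicate⁺ p (ℤ.+≤+ z≤n)) (ℤ.-≤+ ∷ []) ,
  trans (length-snoc (origin p) _) (cong suc (length-origin p))

-- From the point h ∷ U ++ 0ᶜ (h ≤ 0, U ≤ 0, |U| = p, p + c = m) every segment σ(j) with
-- j ≤ n + 1 + c ascends: a returning σ(j) only carries its coordinate back past zeros.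
σ-ascends-from-sink : ∀ m p c h U → p + c ≡ m → length U ≡ p → h ℤ.≤ 0ℤ → All (ℤ._≤ 0ℤ) U →
  ∀ {j} → Shape m j → j ≤ suc (suc m) + c → Ascending (σℕ (suc m) j) (h ∷ U ++ origin c)
σ-ascends-from-sink m p c h U p+c≡m |U|≡p h≤0 U≤0 (descending b b≤m) _ =
  σ-ascends-descending m b h (U ++ origin c) b≤m (trans (length-++ U) (trans (cong₂ _+_ |U|≡p (length-origin c)) p+c≡m))
    h≤0 (AllP.++⁺ U≤0 (AllP.replicate⁺ c (ℤ.+≤+ z≤n)))
σ-ascends-from-sink m p c h U p+c≡m |U|≡p h≤0 U≤0 (returning p′ c′ p′+c′≡m) j≤k =
  subst (λ x → Ascending (σℕ (suc m) (suc (suc m) + c′)) (h ∷ x)) split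
    (σ-ascends-returning m p′ c′ h (U ++ origin (c ∸ c′)) p′+c′≡m |U′|≡p′ h≤0 (AllP.++⁺ U≤0 (AllP.replicate⁺ (c ∸ c′) (ℤ.+≤+ z≤n))))
  where
  c′≤c : c′ ≤ c
  c′≤c = ℕₚ.+-cancelˡ-≤ (suc (suc m)) c′ c j≤k
  split : (U ++ origin (c ∸ c′)) ++ origin c′ ≡ U ++ origin c
  split = trans (++-assoc U _ _) (cong (U ++_) (trans (sym (origin-+ (c ∸ c′) c′)) (cong origin (ℕₚ.m∸n+n≡m c′≤c))))
  |U′|≡p′ : length (U ++ origin (c ∸ c′)) ≡ p′
  |U′|≡p′ = ℕₚ.+-cancelʳ-≡ c′ _ p′ (begin
    length (U ++ origin (c ∸ c′)) + c′  ≡⟨ cong (_+ c′) (trans (length-++ U) (cong₂ _+_ |U|≡p (length-origin (c ∸ c′)))) ⟩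
    p + (c ∸ c′) + c′                   ≡⟨ ℕₚ.+-assoc p (c ∸ c′) c′ ⟩
    p + (c ∸ c′ + c′)                   ≡⟨ cong (p +_) (ℕₚ.m∸n+n≡m c′≤c) ⟩
    p + c                               ≡⟨ trans p+c≡m (sym p′+c′≡m) ⟩
    p′ + c′                             ∎)
    where open ≡-Reasoning

Admissible : ℕ → ℕ → ℕ → Set
Admissible n j k = j < k ⊎ (n < j × j ≡ k)

admissible⇒≤ : ∀ {n j k} → Admissible n j k → j ≤ k
admissible⇒≤ (inj₁ j<k)       = ℕₚ.<⇒≤ j<k
admissible⇒≤ (inj₂ (_ , j≡k)) = ℕₚ.≤-reflexive j≡k

-- Forward direction: for an admissible pair, σ(j)σ(k) ascends from the origin.  For k ≤ n this
-- forces j < k, and σ(j) ascends from the unit vector σ(k)·0; otherwise σ(k)·0 is a sink point.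
σσ-ascending : ∀ m j k → Shape m j → Shape m k → Admissible (suc m) j k →
  Ascending (σℕ (suc m) j ++ σℕ (suc m) k) (origin (suc m))
σσ-ascending m _ _ (descending b b≤m) (descending a a≤m) (inj₁ (s≤s b<a)) =
  ascending-++ _ _ _ (proj₂ walk) (subst (Ascending _) (sym (proj₁ walk)) (σ-ascends-from-unit m a b b<a a≤m))
  where
  walk : Walk (σℕ (suc m) (suc a)) (origin (suc m)) (origin a ++ 1ℤ ∷ origin (m ∸ a))
  walk = σ-from-origin-descending m a a≤m
σσ-ascending m _ _ (descending b b≤m) (descending a a≤m) (inj₂ (n<j , _)) = ⊥-elim (ℕₚ.<⇒≱ n<j (s≤s b≤m))
σσ-ascending m _ _ (returning p′ c′ _) (descending a a≤m) adm =
  ⊥-elim (ℕₚ.<-irrefl refl (ℕₚ.<-≤-trans (s≤s (s≤s a≤m)) (ℕₚ.≤-trans (ℕₚ.m≤m+n (suc (suc m)) c′) (admissible⇒≤ adm))))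
σσ-ascending m j _ sj (returning p c p+c≡m) adm with sink-form p c
... | h , U , sink≡ , h≤0 , U≤0 , |U|≡p =
  ascending-++ _ _ _ (proj₂ walk) (subst (Ascending (σℕ (suc m) j)) (sym (trans (proj₁ walk) sink≡))
    (σ-ascends-from-sink m p c h U p+c≡m |U|≡p h≤0 U≤0 sj (admissible⇒≤ adm)))
  where
  walk : Walk (σℕ (suc m) (suc (suc m) + c)) (origin (suc m)) (origin p ++ -[1+ 0 ] ∷ origin c)
  walk = σ-from-origin-returning m p c p+c≡m

module Relations (n : ℕ) where

  -- u ≃ v: the index words u and v spell the same element of W̃.  (A record, so that u and v
  -- stay inferable from a proof.)
  infix 4 _≃_
  record _≃_ (u v : List ℕ) : Set where
    constructor spells
    field spelled : map (gen n) u ≈ map (gen n) v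
  open _≃_ public

  ≃-setoid : Setoid 0ℓ 0ℓ
  ≃-setoid = record
    { Carrier       = List ℕ
    ; _≈_           = _≃_
    ; isEquivalence = record
      { refl  = spells ≈-refl
      ; sym   = λ (spells u≈v) → spells (≈-sym u≈v)
      ; trans = λ (spells u≈v) (spells v≈w) → spells (≈-trans u≈v v≈w) } }

  open Setoid ≃-setoid public using () renaming (refl to ≃-refl; reflexive to ≃-reflexive; sym to ≃-sym; trans to ≃-trans)
  open import Relation.Binary.Reasoning.Setoid ≃-setoid public

  ≃-context : ∀ x {u v} y → u ≃ v → x ++ u ++ y ≃ x ++ v ++ y
  ≃-context x {u} {v} y (spells u≈v) = spells (subst₂ _≈_ (sym (spell u)) (sym (spell v)) (≈-ctx (map (gen n) x) (map (gen n) y) u≈v))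
    where
    spell : ∀ w → map (gen n) (x ++ w ++ y) ≡ map (gen n) x ++ map (gen n) w ++ map (gen n) y
    spell w = trans (map-++ (gen n) x (w ++ y)) (cong (map (gen n) x ++_) (map-++ (gen n) w y))

  ≃-prefix : ∀ x {u v} → u ≃ v → x ++ u ≃ x ++ v
  ≃-prefix x {u} {v} u≃v = subst₂ _≃_ (cong (x ++_) (++-identityʳ u)) (cong (x ++_) (++-identityʳ v)) (≃-context x [] u≃v)

  ≃-suffix : ∀ {u v} y → u ≃ v → u ++ y ≃ v ++ y
  ≃-suffix y = ≃-context [] y

  square : ∀ a → a ∷ a ∷ [] ≃ []
  square a = spells (≈-sq (gen n a))

  braid-gen : ∀ a b k → a ≤ n → b ≤ n → a ≢ b → coxℕ n a b ≡ k →
    alt (gen n a) (gen n b) k ≈ alt (gen n b) (gen n a) k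
  braid-gen a b k a≤n b≤n a≢b m≡k = subst (λ k → alt (gen n a) (gen n b) k ≈ alt (gen n b) (gen n a) k)
    (trans (cong₂ (coxℕ n) (toℕ-gen n a a≤n) (toℕ-gen n b b≤n)) m≡k)
    (≈-braid (gen n a) (gen n b) (λ eq → a≢b (trans (sym (toℕ-gen n a a≤n)) (trans (cong toℕ eq) (toℕ-gen n b b≤n)))))

  commute : ∀ a b → suc a < b → b ≤ n → a ∷ b ∷ [] ≃ b ∷ a ∷ []
  commute a b a+1<b b≤n = spells (braid-gen a b 2 (ℕₚ.≤-trans (ℕₚ.≤-trans (ℕₚ.n≤1+n a) (ℕₚ.<⇒≤ a+1<b)) b≤n) b≤n
    (λ a≡b → ℕₚ.<-irrefl a≡b (ℕₚ.<-trans (ℕₚ.n<1+n a) a+1<b))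
    (subst (λ b → coxℕ n a b ≡ 2) b≡ (cox-far n a (b ∸ suc (suc a)) (subst (_≤ n) (sym b≡) b≤n))))
    where
    b≡ : 2 + a + (b ∸ suc (suc a)) ≡ b
    b≡ = ℕₚ.m+[n∸m]≡n a+1<b

  braid-middle-letters : ∀ i → 3 + i ≤ n → (1 + i) ∷ (2 + i) ∷ (1 + i) ∷ [] ≃ (2 + i) ∷ (1 + i) ∷ (2 + i) ∷ []
  braid-middle-letters i le = spells (braid-gen (1 + i) (2 + i) 3 (ℕₚ.<⇒≤ (ℕₚ.<⇒≤ le)) (ℕₚ.<⇒≤ le) (λ ()) (cox-middle n i le))

  braid₀₁-letters : 2 ≤ n → 0 ∷ 1 ∷ 0 ∷ 1 ∷ [] ≃ 1 ∷ 0 ∷ 1 ∷ 0 ∷ []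
  braid₀₁-letters 2≤n = spells (braid-gen 0 1 4 z≤n (ℕₚ.<⇒≤ 2≤n) (λ ()) refl)

  braid-end-letters : ∀ i → n ≡ 2 + i → (1 + i) ∷ (2 + i) ∷ (1 + i) ∷ (2 + i) ∷ [] ≃ (2 + i) ∷ (1 + i) ∷ (2 + i) ∷ (1 + i) ∷ []
  braid-end-letters i refl = spells (braid-gen (1 + i) (2 + i) 4 (ℕₚ.n≤1+n _) ℕₚ.≤-refl (λ ()) (cox-end i))

  Far : ℕ → ℕ → Set
  Far a b = (suc a < b × b ≤ n) ⊎ (suc b < a × a ≤ n)

  commute-far : ∀ {a b} → Far a b → a ∷ b ∷ [] ≃ b ∷ a ∷ []
  commute-far {a} {b} (inj₁ (a+1<b , b≤n)) = commute a b a+1<b b≤n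
  commute-far {a} {b} (inj₂ (b+1<a , a≤n)) = ≃-sym (commute b a b+1<a a≤n)

  pass : ∀ a l → All (Far a) l → a ∷ l ≃ l ++ [ a ]
  pass a []      []           = ≃-refl
  pass a (b ∷ l) (far ∷ fars) = ≃-trans (≃-suffix l (commute-far far)) (≃-prefix [ b ] (pass a l fars))

  pass-block : ∀ l₁ l₂ → All (λ a → All (Far a) l₂) l₁ → l₁ ++ l₂ ≃ l₂ ++ l₁
  pass-block []       l₂ []           = ≃-sym (≃-reflexive (++-identityʳ l₂))
  pass-block (a ∷ l₁) l₂ (far ∷ fars) = begin
    a ∷ (l₁ ++ l₂)        ≈⟨ ≃-prefix [ a ] (pass-block l₁ l₂ fars) ⟩
    (a ∷ l₂) ++ l₁        ≈⟨ ≃-suffix l₁ (pass a l₂ far) ⟩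
    (l₂ ++ [ a ]) ++ l₁   ≡⟨ ++-assoc l₂ [ a ] l₁ ⟩
    l₂ ++ a ∷ l₁          ∎

  -- Conjugating by the Coxeter element s_l ⋯ s₁ shifts indices: (s_l ⋯ s₁) s_{a+1} = s_a (s_l ⋯ s₁)
  -- for 1 ≤ a < l < n; written with a = 1 + d and l = 2 + d + e.
  shift : ∀ d e → 3 + d + e ≤ n → down 1 (2 + d + e) ++ [ 2 + d ] ≃ (1 + d) ∷ down 1 (2 + d + e)
  shift d e le = begin
    down 1 (2 + d + e) ++ [ 2 + d ]                   ≡⟨ cong (_++ [ 2 + d ]) (down-+ 1 (2 + d) e) ⟩
    (H ++ (2 + d) ∷ (1 + d) ∷ L) ++ [ 2 + d ]         ≡⟨ ++-assoc H _ _ ⟩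
    H ++ (2 + d) ∷ (1 + d) ∷ (L ++ [ 2 + d ])         ≈⟨ ≃-prefix H (≃-prefix ((2 + d) ∷ (1 + d) ∷ []) (≃-sym (pass (2 + d) L L-far))) ⟩
    H ++ (2 + d) ∷ (1 + d) ∷ (2 + d) ∷ L              ≈⟨ ≃-context H L (≃-sym (braid-middle-letters d (ℕₚ.≤-trans (ℕₚ.m≤m+n (3 + d) e) le))) ⟩
    H ++ (1 + d) ∷ (2 + d) ∷ (1 + d) ∷ L              ≡⟨ ++-assoc H [ 1 + d ] _ ⟨
    (H ++ [ 1 + d ]) ++ (2 + d) ∷ (1 + d) ∷ L         ≈⟨ ≃-suffix _ (≃-sym (pass (1 + d) H H-far)) ⟩
    (1 + d) ∷ H ++ (2 + d) ∷ (1 + d) ∷ L              ≡⟨ cong ((1 + d) ∷_) (down-+ 1 (2 + d) e) ⟨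
    (1 + d) ∷ down 1 (2 + d + e)                      ∎
    where
    H : List ℕ
    H = down (3 + d) e
    L : List ℕ
    L = down 1 d
    L-far : All (Far (2 + d)) L
    L-far = All.map (λ (_ , x<1+d) → inj₂ (s≤s x<1+d , ℕₚ.≤-trans (ℕₚ.n≤1+n _) (ℕₚ.≤-trans (ℕₚ.m≤m+n (3 + d) e) le)))
      (down-bounds 1 d)
    H-far : All (Far (1 + d)) H
    H-far = All.map (λ (3+d≤x , x<) → inj₁ (3+d≤x , ℕₚ.<⇒≤ (ℕₚ.<-≤-trans x< le))) (down-bounds (3 + d) e)

  coxeter-shift : ∀ l w → 1 + l ≤ n → All (λ x → 1 ≤ x × x < l) w → down 1 l ++ map suc w ≃ w ++ down 1 l
  coxeter-shift l []      l<n []                      = ≃-reflexive (++-identityʳ (down 1 l))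
  coxeter-shift l (a ∷ w) l<n ((1≤a , a<l) ∷ w-bounds) = begin
    down 1 l ++ suc a ∷ map suc w        ≡⟨ ++-assoc (down 1 l) [ suc a ] _ ⟨
    (down 1 l ++ [ suc a ]) ++ map suc w ≈⟨ ≃-suffix (map suc w) (one-letter a 1≤a a<l) ⟩
    a ∷ down 1 l ++ map suc w            ≈⟨ ≃-prefix [ a ] (coxeter-shift l w l<n w-bounds) ⟩
    a ∷ w ++ down 1 l                    ∎
    where
    one-letter : ∀ a → 1 ≤ a → a < l → down 1 l ++ [ suc a ] ≃ a ∷ down 1 l
    one-letter (suc d) _ a<l = subst (λ l → down 1 l ++ [ 2 + d ] ≃ (1 + d) ∷ down 1 l) (ℕₚ.m+[n∸m]≡n a<l)
      (shift d (l ∸ (2 + d)) (subst (λ l → 1 + l ≤ n) (sym (ℕₚ.m+[n∸m]≡n a<l)) l<n))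

  coxeter-square : ∀ l → 2 + l ≤ n → down 1 (suc l) ++ down 1 (suc l) ≃ down 1 l ++ down 2 l
  coxeter-square l le = begin
    A ++ A                                      ≡⟨ cong (A ++_) (down-snoc 1 l) ⟩
    A ++ (down 2 l ++ [ 1 ])                    ≡⟨ cong (λ B → A ++ (B ++ [ 1 ])) (map-suc-down 1 l) ⟨
    A ++ (map suc (down 1 l) ++ [ 1 ])          ≡⟨ ++-assoc A _ [ 1 ] ⟨
    (A ++ map suc (down 1 l)) ++ [ 1 ]          ≈⟨ ≃-suffix [ 1 ] (coxeter-shift (suc l) (down 1 l) le (down-bounds 1 l)) ⟩
    (down 1 l ++ A) ++ [ 1 ]                    ≡⟨ cong (λ A′ → (down 1 l ++ A′) ++ [ 1 ]) (down-snoc 1 l) ⟩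
    (down 1 l ++ (down 2 l ++ [ 1 ])) ++ [ 1 ]  ≡⟨ trans (++-assoc (down 1 l) _ [ 1 ]) (cong (down 1 l ++_) (++-assoc (down 2 l) [ 1 ] [ 1 ])) ⟩
    down 1 l ++ down 2 l ++ 1 ∷ 1 ∷ []          ≈⟨ ≃-prefix (down 1 l) (≃-prefix (down 2 l) (square 1)) ⟩
    down 1 l ++ down 2 l ++ []                  ≡⟨ cong (down 1 l ++_) (++-identityʳ (down 2 l)) ⟩
    down 1 l ++ down 2 l                        ∎
    where
    A : List ℕ
    A = down 1 (suc l)

  -- For k = l + 2 ≤ n, writing Dₖ = s_{k−1} ⋯ s₀ for the descending segment σ(k):
  -- Dₖ Dₖ s₁ = D_{k−1} Dₖ.  Uses s₀ s₁ s₀ s₁ = s₁ s₀ s₁ s₀ and the Coxeter square above.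
  run-square : ∀ l → 2 + l ≤ n → down 0 (2 + l) ++ down 0 (2 + l) ++ [ 1 ] ≃ down 0 (1 + l) ++ down 0 (2 + l)
  run-square l le = begin
    D ++ D ++ [ 1 ]                          ≡⟨ cong₂ (λ X Y → X ++ Y ++ [ 1 ]) D≡ D≡ ⟩
    (A ++ [ 0 ]) ++ (A ++ [ 0 ]) ++ [ 1 ]    ≡⟨ trans (++-assoc A [ 0 ] _) (cong (λ X → A ++ 0 ∷ X) (++-assoc A [ 0 ] [ 1 ])) ⟩
    A ++ 0 ∷ A ++ 0 ∷ 1 ∷ []                 ≡⟨ cong (λ X → A ++ 0 ∷ X) (trans (cong (_++ 0 ∷ 1 ∷ []) A≡) (++-assoc B [ 1 ] _)) ⟩
    A ++ 0 ∷ B ++ 1 ∷ 0 ∷ 1 ∷ []             ≈⟨ ≃-prefix A (≃-suffix (1 ∷ 0 ∷ 1 ∷ []) (pass 0 B B-far)) ⟩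
    A ++ ((B ++ [ 0 ]) ++ 1 ∷ 0 ∷ 1 ∷ [])    ≡⟨ cong (A ++_) (++-assoc B [ 0 ] _) ⟩
    A ++ B ++ 0 ∷ 1 ∷ 0 ∷ 1 ∷ []             ≈⟨ ≃-prefix A (≃-prefix B (braid₀₁-letters (ℕₚ.≤-trans (s≤s (s≤s z≤n)) le))) ⟩
    A ++ B ++ 1 ∷ 0 ∷ 1 ∷ 0 ∷ []             ≡⟨ cong (A ++_) (trans (sym (++-assoc B [ 1 ] _)) (cong (_++ 0 ∷ 1 ∷ 0 ∷ []) (sym A≡))) ⟩
    A ++ A ++ 0 ∷ 1 ∷ 0 ∷ []                 ≡⟨ ++-assoc A A _ ⟨
    (A ++ A) ++ 0 ∷ 1 ∷ 0 ∷ []               ≈⟨ ≃-suffix (0 ∷ 1 ∷ 0 ∷ []) (coxeter-square l le) ⟩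
    (down 1 l ++ B) ++ 0 ∷ 1 ∷ 0 ∷ []        ≡⟨ trans (++-assoc (down 1 l) B _) (cong (down 1 l ++_) (sym (++-assoc B [ 0 ] _))) ⟩
    down 1 l ++ (B ++ [ 0 ]) ++ 1 ∷ 0 ∷ []   ≈⟨ ≃-prefix (down 1 l) (≃-suffix (1 ∷ 0 ∷ []) (≃-sym (pass 0 B B-far))) ⟩
    down 1 l ++ 0 ∷ B ++ 1 ∷ 0 ∷ []          ≡⟨ cong (λ X → down 1 l ++ 0 ∷ X) (trans (sym (++-assoc B [ 1 ] [ 0 ])) (cong (_++ [ 0 ]) (sym A≡))) ⟩
    down 1 l ++ 0 ∷ A ++ [ 0 ]               ≡⟨ trans (sym (++-assoc (down 1 l) [ 0 ] _)) (cong₂ _++_ (sym (down-snoc 0 l)) (sym D≡)) ⟩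
    down 0 (1 + l) ++ D                      ∎
    where
    D : List ℕ
    D = down 0 (2 + l)
    A : List ℕ
    A = down 1 (1 + l)
    B : List ℕ
    B = down 2 l
    B-far : All (Far 0) B
    B-far = All.map (λ (2≤x , x<) → inj₁ (2≤x , ℕₚ.<⇒≤ (ℕₚ.<-≤-trans x< le))) (down-bounds 2 l)
    A≡ : A ≡ B ++ [ 1 ]
    A≡ = down-snoc 1 l
    D≡ : D ≡ A ++ [ 0 ]
    D≡ = down-snoc 0 (1 + l)

  run-square′ : ∀ l → 2 + l ≤ n → down 0 (1 + l) ++ down 0 (2 + l) ++ [ 1 ] ≃ down 0 (2 + l) ++ down 0 (2 + l)
  run-square′ l le = begin
    down 0 (1 + l) ++ D ++ [ 1 ]       ≡⟨ ++-assoc (down 0 (1 + l)) D [ 1 ] ⟨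
    (down 0 (1 + l) ++ D) ++ [ 1 ]     ≈⟨ ≃-suffix [ 1 ] (≃-sym (run-square l le)) ⟩
    (D ++ D ++ [ 1 ]) ++ [ 1 ]         ≡⟨ trans (++-assoc D _ [ 1 ]) (cong (D ++_) (++-assoc D [ 1 ] [ 1 ])) ⟩
    D ++ D ++ 1 ∷ 1 ∷ []               ≈⟨ ≃-prefix D (≃-prefix D (square 1)) ⟩
    D ++ D ++ []                       ≡⟨ cong (D ++_) (++-identityʳ D) ⟩
    D ++ D                             ∎
    where
    D : List ℕ
    D = down 0 (2 + l)

  reflection : ℕ → ℕ → List ℕ
  reflection q c = up q c ++ n ∷ down q c

  reflection-unfold : ∀ q c → reflection q (suc c) ≡ q ∷ (reflection (suc q) c ++ [ q ])
  reflection-unfold q c = cong (q ∷_) (trans (cong (λ D → up (suc q) c ++ n ∷ D) (down-snoc q c))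
    (sym (++-assoc (up (suc q) c) (n ∷ down (suc q) c) [ q ])))

  reflection-bounds : ∀ q c → q + c ≡ n → All (λ x → q ≤ x × x ≤ n) (reflection q c)
  reflection-bounds q c q+c≡n = AllP.++⁺
    (All.map (Prod.map₂ (λ x< → ℕₚ.<⇒≤ (subst (_ <_) q+c≡n x<))) (up-bounds q c))
    ((subst (q ≤_) q+c≡n (ℕₚ.m≤m+n q c) , ℕₚ.≤-refl) ∷
      All.map (Prod.map₂ (λ x< → ℕₚ.<⇒≤ (subst (_ <_) q+c≡n x<))) (down-bounds q c))

  braid-lift : ∀ a b X → a ∷ b ∷ a ∷ [] ≃ b ∷ a ∷ b ∷ [] → a ∷ X ≃ X ++ [ a ] →
    b ∷ X ++ b ∷ X ≃ X ++ b ∷ X ++ [ b ] →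
    a ∷ b ∷ X ++ b ∷ a ∷ b ∷ X ++ [ b ] ≃ b ∷ X ++ b ∷ a ∷ b ∷ X ++ b ∷ a ∷ []
  braid-lift a b X aba≃bab aX≃Xa bXbX≃XbXb = begin
    a ∷ b ∷ X ++ b ∷ a ∷ b ∷ X ++ [ b ]       ≈⟨ ≃-prefix (a ∷ b ∷ []) (≃-prefix X (≃-suffix (X ++ [ b ]) (≃-sym aba≃bab))) ⟩
    a ∷ b ∷ X ++ a ∷ b ∷ a ∷ X ++ [ b ]       ≈⟨ ≃-prefix (a ∷ b ∷ []) (≃-sym (move (b ∷ a ∷ X ++ [ b ]))) ⟩
    a ∷ b ∷ a ∷ X ++ b ∷ a ∷ X ++ [ b ]       ≈⟨ ≃-prefix (a ∷ b ∷ a ∷ []) (≃-prefix X (≃-prefix [ b ] (move [ b ]))) ⟩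
    a ∷ b ∷ a ∷ X ++ b ∷ X ++ a ∷ b ∷ []      ≈⟨ ≃-suffix (X ++ b ∷ X ++ a ∷ b ∷ []) aba≃bab ⟩
    b ∷ a ∷ b ∷ X ++ b ∷ X ++ a ∷ b ∷ []      ≡⟨ cong (λ Z → b ∷ a ∷ b ∷ Z) (sym (++-assoc X (b ∷ X) (a ∷ b ∷ []))) ⟩
    b ∷ a ∷ ((b ∷ X ++ b ∷ X) ++ a ∷ b ∷ [])  ≈⟨ ≃-prefix (b ∷ a ∷ []) (≃-suffix (a ∷ b ∷ []) bXbX≃XbXb) ⟩
    b ∷ a ∷ ((X ++ b ∷ X ++ [ b ]) ++ a ∷ b ∷ []) ≡⟨ cong (λ Z → b ∷ a ∷ Z) (trans (++-assoc X _ _) (cong (λ W → X ++ b ∷ W) (++-assoc X [ b ] _))) ⟩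
    b ∷ a ∷ X ++ b ∷ X ++ b ∷ a ∷ b ∷ []      ≈⟨ ≃-prefix (b ∷ a ∷ []) (≃-prefix X (≃-prefix [ b ] (≃-prefix X (≃-sym aba≃bab)))) ⟩
    b ∷ a ∷ X ++ b ∷ X ++ a ∷ b ∷ a ∷ []      ≈⟨ ≃-sym (≃-prefix (b ∷ a ∷ []) (≃-prefix X (≃-prefix [ b ] (move (b ∷ a ∷ []))))) ⟩
    b ∷ a ∷ X ++ b ∷ a ∷ X ++ b ∷ a ∷ []      ≈⟨ ≃-prefix [ b ] (move (b ∷ a ∷ X ++ b ∷ a ∷ [])) ⟩
    b ∷ X ++ a ∷ b ∷ a ∷ X ++ b ∷ a ∷ []      ≈⟨ ≃-prefix [ b ] (≃-prefix X (≃-suffix (X ++ b ∷ a ∷ []) aba≃bab)) ⟩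
    b ∷ X ++ b ∷ a ∷ b ∷ X ++ b ∷ a ∷ []      ∎
    where
    move : ∀ Z → a ∷ X ++ Z ≃ X ++ a ∷ Z
    move Z = subst (a ∷ X ++ Z ≃_) (++-assoc X [ a ] Z) (≃-suffix Z aX≃Xa)

  reflection-braid : ∀ c p → suc p + c ≡ n → 1 ≤ p →
    p ∷ reflection (suc p) c ++ p ∷ reflection (suc p) c ≃ reflection (suc p) c ++ p ∷ reflection (suc p) c ++ [ p ]
  reflection-braid zero    (suc i) p+1≡n _ = subst (λ N → suc i ∷ N ∷ suc i ∷ N ∷ [] ≃ N ∷ suc i ∷ N ∷ suc i ∷ [])
    (sym n≡) (braid-end-letters i n≡)
    where
    n≡ : n ≡ suc (suc i)
    n≡ = trans (sym p+1≡n) (ℕₚ.+-identityʳ _)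
  reflection-braid (suc c) p@(suc i) p+c≡n _ = subst₂ _≃_ (sym left≡) (sym right≡)
    (braid-lift p (suc p) X (braid-middle-letters i 2+p≤n) (pass p X X-far) (reflection-braid c (suc p) p+c≡n′ (s≤s z≤n)))
    where
    X : List ℕ
    X = reflection (suc (suc p)) c
    p+c≡n′ : suc (suc p) + c ≡ n
    p+c≡n′ = trans (sym (ℕₚ.+-suc (suc p) c)) p+c≡n
    2+p≤n : 2 + p ≤ n
    2+p≤n = subst (suc (suc p) ≤_) p+c≡n′ (ℕₚ.m≤m+n (suc (suc p)) c)
    X-far : All (Far p) X
    X-far = All.map (λ (2+p≤x , x≤n) → inj₁ (2+p≤x , x≤n)) (reflection-bounds (suc (suc p)) c p+c≡n′)
    left≡ : p ∷ reflection (suc p) (suc c) ++ p ∷ reflection (suc p) (suc c) ≡ p ∷ suc p ∷ X ++ suc p ∷ p ∷ suc p ∷ X ++ [ suc p ]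
    left≡ = trans (cong (λ Y → p ∷ Y ++ p ∷ Y) (reflection-unfold (suc p) c)) (cong (λ Z → p ∷ suc p ∷ Z) (++-assoc X [ suc p ] _))
    right≡ : reflection (suc p) (suc c) ++ p ∷ reflection (suc p) (suc c) ++ [ p ] ≡ suc p ∷ X ++ suc p ∷ p ∷ suc p ∷ X ++ suc p ∷ p ∷ []
    right≡ = trans (cong (λ Y → Y ++ p ∷ Y ++ [ p ]) (reflection-unfold (suc p) c))
      (cong (suc p ∷_) (trans (++-assoc X [ suc p ] _) (cong (λ Z → X ++ suc p ∷ p ∷ suc p ∷ Z) (++-assoc X [ suc p ] [ p ]))))

  -- With S = s_{p+1} ⋯ s_{n−1} s_n ⋯ s₀ the returning segment σ(n + 1 + c), p + 1 + c = n, and p ≥ 1: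
  -- s_p S S s₁ = S S.  Writing S = R D_{p+1} with R the reflection above, this combines the
  -- run square D_p D_{p+1} s₁ = D_{p+1} D_{p+1}, the braid s_p R s_p R = R s_p R s_p, and the fact that
  -- D_p commutes with R.
  returning-square : ∀ p c → suc p + c ≡ n → 1 ≤ p →
    p ∷ (up (suc p) c ++ down 0 (suc n)) ++ (up (suc p) c ++ down 0 (suc n)) ++ [ 1 ] ≃
    (up (suc p) c ++ down 0 (suc n)) ++ (up (suc p) c ++ down 0 (suc n))
  returning-square p@(suc l) c p+c≡n _ = subst (λ S → p ∷ S ++ S ++ [ 1 ] ≃ S ++ S) (sym S≡) (begin
    p ∷ (R ++ Dq) ++ (R ++ Dq) ++ [ 1 ]   ≡⟨ cong (p ∷_) (trans (++-assoc R Dq _) (cong (λ Y → R ++ Dq ++ Y) (++-assoc R Dq [ 1 ]))) ⟩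
    p ∷ R ++ p ∷ Dp ++ R ++ Dq ++ [ 1 ]   ≈⟨ ≃-prefix [ p ] (≃-prefix R (≃-prefix [ p ] (commute-runs (Dq ++ [ 1 ])))) ⟩
    p ∷ R ++ p ∷ R ++ Dp ++ Dq ++ [ 1 ]   ≈⟨ ≃-prefix [ p ] (≃-prefix R (≃-prefix [ p ] (≃-prefix R (run-square′ l p+1≤n)))) ⟩
    p ∷ R ++ p ∷ R ++ Dq ++ Dq            ≡⟨ cong (p ∷_) (sym (++-assoc R (p ∷ R) (Dq ++ Dq))) ⟩
    (p ∷ R ++ p ∷ R) ++ Dq ++ Dq          ≈⟨ ≃-suffix (Dq ++ Dq) (reflection-braid c p p+c≡n (s≤s z≤n)) ⟩
    (R ++ p ∷ R ++ [ p ]) ++ Dq ++ Dq     ≡⟨ trans (++-assoc R _ _) (cong (λ Y → R ++ p ∷ Y) (++-assoc R [ p ] _)) ⟩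
    R ++ p ∷ R ++ p ∷ p ∷ Dp ++ Dq        ≈⟨ ≃-prefix R (≃-prefix [ p ] (≃-prefix R (≃-suffix (Dp ++ Dq) (square p)))) ⟩
    R ++ p ∷ R ++ Dp ++ Dq                ≈⟨ ≃-sym (≃-prefix R (≃-prefix [ p ] (commute-runs Dq))) ⟩
    R ++ p ∷ Dp ++ R ++ Dq                ≡⟨ ++-assoc R Dq (R ++ Dq) ⟨
    (R ++ Dq) ++ R ++ Dq                  ∎)
    where
    R : List ℕ
    R = reflection (suc p) c
    Dp : List ℕ
    Dp = down 0 p
    Dq : List ℕ
    Dq = down 0 (suc p)
    p+1≤n : 2 + l ≤ n
    p+1≤n = subst (suc p ≤_) p+c≡n (ℕₚ.m≤m+n (suc p) c)
    S≡ : up (suc p) c ++ down 0 (suc n) ≡ R ++ Dq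
    S≡ = trans (cong (λ D → up (suc p) c ++ n ∷ D) (trans (cong (down 0) (sym p+c≡n)) (down-+ 0 (suc p) c)))
      (sym (++-assoc (up (suc p) c) (n ∷ down (suc p) c) Dq))
    commute-runs : ∀ Y → Dp ++ R ++ Y ≃ R ++ Dp ++ Y
    commute-runs Y = subst₂ _≃_ (++-assoc Dp R Y) (++-assoc R Dp Y) (≃-suffix Y (pass-block Dp R
      (All.map (λ (_ , x<p) → All.map (λ (p+1≤y , y≤n) → inj₁ (ℕₚ.≤-trans (s≤s x<p) p+1≤y , y≤n))
        (reflection-bounds (suc p) c p+c≡n)) (down-bounds 0 p))))

shortened⇒not-minimal : ∀ m j k (u v : List ℕ) → All (1 ≤_) u → Relations._≃_ (suc m) (σℕ (suc m) j ++ σℕ (suc m) k ++ u) v →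
  length v < j + k → InWS (σ (suc m) j ++ σ (suc m) k) → HasLength (σ (suc m) j ++ σ (suc m) k) (j + k) → ⊥
shortened⇒not-minimal m j k u v 1≤u (Relations.spells wu≈v) |v|<j+k =
  shorter-in-coset (σ n j ++ σ n k) (map (gen n) u) (map (gen n) v) (in-W_S u 1≤u)
    (subst (map (gen n) v ≈_) spell (≈-sym wu≈v)) (subst (_< j + k) (sym (length-map (gen n) v)) |v|<j+k)
  where
  n : ℕ
  n = suc m
  in-W_S : ∀ u → All (1 ≤_) u → SWord (map (gen n) u)
  in-W_S []          []            = []
  in-W_S (suc a ∷ u) (_ ∷ 1≤u)     = (λ ()) ∷ in-W_S u 1≤u
  spell : map (gen n) (σℕ n j ++ σℕ n k ++ u) ≡ (σ n j ++ σ n k) ++ map (gen n) u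
  spell = trans (map-++ (gen n) (σℕ n j) _) (trans (cong (σ n j ++_) (map-++ (gen n) (σℕ n k) u))
    (sym (++-assoc (σ n j) (σ n k) _)))

down-suffix : ∀ a N → suc a ≤ N → down 0 N ≡ down (suc a) (N ∸ suc a) ++ down 0 (suc a)
down-suffix a N a<N = trans (cong (down 0) (sym (ℕₚ.m+[n∸m]≡n a<N))) (down-+ 0 (suc a) (N ∸ suc a))

σ-ends-descending : ∀ {m j} → Shape m j → ∀ a → suc a ≤ j → a ≤ m →
  Σ (List ℕ) λ P → σℕ (suc m) j ≡ P ++ down 0 (suc a) × length P + suc a ≡ j
σ-ends-descending {m} (descending b b≤m) a a<j _ =
  down (suc a) (b ∸ a) , trans (σ-descending m b (ℕₚ.m≤n⇒m≤1+n b≤m)) (down-suffix a (suc b) a<j) ,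
  trans (cong (_+ suc a) (length-down (suc a) (b ∸ a))) (trans (ℕₚ.+-comm (b ∸ a) (suc a)) (ℕₚ.m+[n∸m]≡n a<j))
σ-ends-descending {m} (returning p c p+c≡m) a _ a≤m =
  U ++ down (suc a) (suc m ∸ a) ,
  trans (σ-returning m p c p+c≡m) (trans (cong (U ++_) (down-suffix a (suc (suc m)) (s≤s (ℕₚ.m≤n⇒m≤1+n a≤m))))
    (sym (++-assoc U _ _))) ,
  length≡
  where
  U : List ℕ
  U = up (suc p) c
  length≡ : length (U ++ down (suc a) (suc m ∸ a)) + suc a ≡ suc (suc m) + c
  length≡ = begin
    length (U ++ down (suc a) (suc m ∸ a)) + suc a   ≡⟨ cong (_+ suc a) (trans (length-++ U) (cong₂ _+_ (length-up (suc p) c) (length-down (suc a) (suc m ∸ a)))) ⟩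
    c + (suc m ∸ a) + suc a                          ≡⟨ ℕₚ.+-assoc c _ _ ⟩
    c + (suc m ∸ a + suc a)                          ≡⟨ cong (c +_) (trans (ℕₚ.+-suc (suc m ∸ a) a) (cong suc (ℕₚ.m∸n+n≡m (ℕₚ.m≤n⇒m≤1+n a≤m)))) ⟩
    c + suc (suc m)                                  ≡⟨ ℕₚ.+-comm c _ ⟩
    suc (suc m) + c                                  ∎
    where open ≡-Reasoning

σ-ends-returning : ∀ m p c p′ c′ → p + c ≡ m → p′ + c′ ≡ m → c < c′ →
  σℕ (suc m) (suc (suc m) + c′) ≡ up (suc p′) (c′ ∸ suc c) ++ p ∷ σℕ (suc m) (suc (suc m) + c)
σ-ends-returning m p c p′ c′ p+c≡m p′+c′≡m c<c′ = begin
  σℕ (suc m) (suc (suc m) + c′)                                 ≡⟨ σ-returning m p′ c′ p′+c′≡m ⟩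
  up (suc p′) c′ ++ D                                          ≡⟨ cong (λ l → up (suc p′) l ++ D) c′≡ ⟩
  up (suc p′) (d + suc c) ++ D                                 ≡⟨ cong (_++ D) (up-+ (suc p′) d (suc c)) ⟩
  (up (suc p′) d ++ up (suc p′ + d) (suc c)) ++ D              ≡⟨ cong (λ q → (up (suc p′) d ++ up q (suc c)) ++ D) p≡ ⟩
  (up (suc p′) d ++ p ∷ up (suc p) c) ++ D                     ≡⟨ ++-assoc (up (suc p′) d) _ D ⟩
  up (suc p′) d ++ p ∷ (up (suc p) c ++ D)                     ≡⟨ cong (λ S → up (suc p′) d ++ p ∷ S) (σ-returning m p c p+c≡m) ⟨
  up (suc p′) d ++ p ∷ σℕ (suc m) (suc (suc m) + c)             ∎
  where
  open ≡-Reasoning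
  d : ℕ
  d = c′ ∸ suc c
  D : List ℕ
  D = down 0 (suc (suc m))
  c′≡ : c′ ≡ d + suc c
  c′≡ = sym (ℕₚ.m∸n+n≡m c<c′)
  p≡ : suc p′ + d ≡ p
  p≡ = ℕₚ.+-cancelʳ-≡ c _ p (begin
    suc p′ + d + c      ≡⟨ ℕₚ.+-assoc (suc p′) d c ⟩
    suc p′ + (d + c)    ≡⟨ ℕₚ.+-suc p′ (d + c) ⟨
    p′ + suc (d + c)    ≡⟨ cong (p′ +_) (trans (sym (ℕₚ.+-suc d c)) (sym c′≡)) ⟩
    p′ + c′             ≡⟨ trans p′+c′≡m (sym p+c≡m) ⟩
    p + c               ∎)

-- Backward direction for k = a + 1 ≤ n and j ≥ k.  Writing σ(j) = P σ(k):  σ(j)σ(1) = P s₀ s₀ = P,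
-- and for k ≥ 2, σ(j)σ(k)s₁ = P σ(k−1)σ(k) by the run square; both are shorter than j + k.
descending-case : ∀ m j a → Shape m j → a ≤ m → suc a ≤ j →
  InWS (σ (suc m) j ++ σ (suc m) (suc a)) → HasLength (σ (suc m) j ++ σ (suc m) (suc a)) (j + suc a) → ⊥
descending-case m j a sj a≤m a<j with σ-ends-descending sj a a<j a≤m
descending-case m j zero    sj a≤m a<j | P , σj≡ , |P|+1≡j =
  shortened⇒not-minimal m j 1 [] P [] (begin
    σℕ (suc m) j ++ σℕ (suc m) 1 ++ []   ≡⟨ cong₂ (λ X Y → X ++ Y ++ []) σj≡ (σ-descending m 0 z≤n) ⟩
    (P ++ [ 0 ]) ++ [ 0 ] ++ []          ≡⟨ ++-assoc P [ 0 ] _ ⟩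
    P ++ 0 ∷ 0 ∷ []                      ≈⟨ ≃-prefix P (square 0) ⟩
    P ++ []                              ≡⟨ ++-identityʳ P ⟩
    P                                    ∎)
    (subst (length P <_) (cong (_+ 1) |P|+1≡j) (ℕₚ.<-≤-trans (ℕₚ.m<m+n (length P) (s≤s z≤n)) (ℕₚ.m≤m+n (length P + 1) 1)))
  where open Relations (suc m)
descending-case m j (suc l) sj a≤m a<j | P , σj≡ , |P|+k≡j =
  shortened⇒not-minimal m j k [ 1 ] (P ++ down 0 (1 + l) ++ D) (s≤s z≤n ∷ []) (begin
    σℕ (suc m) j ++ σℕ (suc m) k ++ [ 1 ]   ≡⟨ cong₂ (λ X Y → X ++ Y ++ [ 1 ]) σj≡ (σ-descending m (suc l) (ℕₚ.m≤n⇒m≤1+n a≤m)) ⟩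
    (P ++ D) ++ D ++ [ 1 ]                  ≡⟨ ++-assoc P D _ ⟩
    P ++ D ++ D ++ [ 1 ]                    ≈⟨ ≃-prefix P (run-square l (s≤s a≤m)) ⟩
    P ++ down 0 (1 + l) ++ D                ∎)
    (subst₂ _<_ (sym (trans (length-++ P) (cong (length P +_) (trans (length-++ (down 0 (1 + l))) (cong₂ _+_ (length-down 0 (1 + l)) (length-down 0 k))))))
      (cong (_+ k) |P|+k≡j) (shorter (length P) l))
  where
  open Relations (suc m)
  k : ℕ
  k = 2 + l
  D : List ℕ
  D = down 0 k
  shorter : ∀ x l → x + ((1 + l) + (2 + l)) < x + (2 + l) + (2 + l)
  shorter x l = subst (x + ((1 + l) + (2 + l)) <_) (e x l) (ℕₚ.n<1+n _)
    where
    e : ∀ x l → suc (x + ((1 + l) + (2 + l))) ≡ x + (2 + l) + (2 + l)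
    e = NS.solve-∀

-- Backward direction for two returning segments with c < c′:  σ(j) = U s_p σ(k), and
-- σ(j)σ(k)s₁ = U s_p S S s₁ = U S S by the returning square, which is shorter than j + k.
returning-case : ∀ m p c p′ c′ → p + c ≡ m → p′ + c′ ≡ m → c < c′ →
  let j = suc (suc m) + c′ ; k = suc (suc m) + c in
  InWS (σ (suc m) j ++ σ (suc m) k) → HasLength (σ (suc m) j ++ σ (suc m) k) (j + k) → ⊥
returning-case m p c p′ c′ p+c≡m p′+c′≡m c<c′ =
  shortened⇒not-minimal m j k [ 1 ] (U ++ S ++ S) (s≤s z≤n ∷ []) (begin
    σℕ (suc m) j ++ S ++ [ 1 ]       ≡⟨ cong (_++ S ++ [ 1 ]) (σ-ends-returning m p c p′ c′ p+c≡m p′+c′≡m c<c′) ⟩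
    (U ++ p ∷ S) ++ S ++ [ 1 ]       ≡⟨ ++-assoc U (p ∷ S) _ ⟩
    U ++ p ∷ S ++ S ++ [ 1 ]         ≈⟨ ≃-prefix U (subst (λ S → p ∷ S ++ S ++ [ 1 ] ≃ S ++ S) (sym (σ-returning m p c p+c≡m))
                                          (returning-square p c (cong suc p+c≡m) 1≤p)) ⟩
    U ++ S ++ S                      ∎)
    (subst₂ _<_ (sym (trans (length-++ U) (cong (length U +_) (length-++ S))))
      (trans (cong (λ x → length U + suc x + x) (length-σ (returning p c p+c≡m))) (cong (_+ k) |j|≡))
      (shorter (length U) (length S)))
  where
  open Relations (suc m)
  j : ℕ
  j = suc (suc m) + c′
  k : ℕ
  k = suc (suc m) + c
  U : List ℕ
  U = up (suc p′) (c′ ∸ suc c)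
  S : List ℕ
  S = σℕ (suc m) k
  1≤p : 1 ≤ p
  1≤p = positive p p+c≡m
    where
    positive : ∀ q → q + c ≡ m → 1 ≤ q
    positive (suc _) _   = s≤s z≤n
    positive zero    c≡m = ⊥-elim (ℕₚ.<⇒≱ c<c′ (subst (c′ ≤_) (trans p′+c′≡m (sym c≡m)) (ℕₚ.m≤n+m c′ p′)))
  |j|≡ : length U + suc k ≡ j
  |j|≡ = trans (cong (λ x → length U + suc x) (sym (length-σ (returning p c p+c≡m))))
    (trans (sym (length-++ U))
    (trans (cong length (sym (σ-ends-returning m p c p′ c′ p+c≡m p′+c′≡m c<c′))) (length-σ (returning p′ c′ p′+c′≡m))))
  shorter : ∀ x s → x + (s + s) < x + suc s + s
  shorter x s = subst (x + (s + s) <_) (e x s) (ℕₚ.n<1+n _)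
    where
    e : ∀ x s → suc (x + (s + s)) ≡ x + suc s + s
    e = NS.solve-∀

admissible⇒minimal : ∀ m j k → 1 ≤ m → Shape m j → Shape m k → Admissible (suc m) j k →
  InWS (σ (suc m) j ++ σ (suc m) k) × HasLength (σ (suc m) j ++ σ (suc m) k) (j + k)
admissible⇒minimal m j k 1≤m sj sk admissible =
  subst₂ (λ w L → InWS w × HasLength w L) (map-++ (gen (suc m)) (σℕ (suc m) j) (σℕ (suc m) k))
    (trans (length-++ (σℕ (suc m) j)) (cong₂ _+_ (length-σ sj) (length-σ sk)))
    (ascending⇒minimal (suc m) (s≤s 1≤m) (σℕ (suc m) j ++ σℕ (suc m) k) (AllP.++⁺ (σ-letters sj) (σ-letters sk))
      (σσ-ascending m j k sj sk admissible))

minimal⇒admissible : ∀ m j k → Shape m j → Shape m k → ¬ Admissible (suc m) j k →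
  InWS (σ (suc m) j ++ σ (suc m) k) → HasLength (σ (suc m) j ++ σ (suc m) k) (j + k) → ⊥
minimal⇒admissible m j _ sj (descending a a≤m) ¬adm =
  descending-case m j a sj a≤m (ℕₚ.≮⇒≥ (λ j<k → ¬adm (inj₁ j<k)))
minimal⇒admissible m _ _ (descending b b≤m) (returning p c _) ¬adm =
  ⊥-elim (¬adm (inj₁ (ℕₚ.≤-trans (s≤s (s≤s b≤m)) (ℕₚ.m≤m+n (suc (suc m)) c))))
minimal⇒admissible m _ _ (returning p′ c′ p′+c′≡m) (returning p c p+c≡m) ¬adm with ℕₚ.<-cmp c c′
... | tri< c<c′ _ _ = returning-case m p c p′ c′ p+c≡m p′+c′≡m c<c′
... | tri≈ _ refl _ = ⊥-elim (¬adm (inj₂ (ℕₚ.m≤m+n (suc (suc m)) c , refl)))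
... | tri> _ _ c′<c = ⊥-elim (¬adm (inj₁ (ℕₚ.+-monoʳ-< (suc (suc m)) c′<c)))

corollary6p5 : ∀ (n : ℕ) → 2 ≤ n → ∀ (j k : ℕ) → 1 ≤ j → j ≤ 2 * n → 1 ≤ k → k ≤ 2 * n →
    ((InWS (σ n j ++ σ n k) × HasLength (σ n j ++ σ n k) (j + k)) ⇔ (j < k ⊎ (n < j × j ≡ k)))
corollary6p5 (suc m) (s≤s 1≤m) j k 1≤j j≤2n 1≤k k≤2n = mk⇔ to (admissible⇒minimal m j k 1≤m sj sk)
  where
  sj : Shape m j
  sj = shape m j 1≤j j≤2n
  sk : Shape m k
  sk = shape m k 1≤k k≤2n
  to : InWS (σ (suc m) j ++ σ (suc m) k) × HasLength (σ (suc m) j ++ σ (suc m) k) (j + k) → Admissible (suc m) j k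
  to (minimal , reduced) with (j <? k) ⊎-dec ((suc m <? j) ×-dec (j ≟ k))
  ... | yes admissible = admissible
  ... | no  ¬adm       = ⊥-elim (minimal⇒admissible m j k sj sk ¬adm minimal reduced)
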